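{- Let $p$ be a prime, $a\in\mathbb{F}_p^\times$, and $m=T^p-T-a\in\mathbb{F}_p[T]$. Let $c_1,c_2\in\mathbb{F}_p[T]$ be coprime to $m$ and suppose $c_2(T)\equiv c_1(T+b)\pmod m$ for some $b\in\mathbb{F}_p$. Then $\pi(N;m,c_1)=\pi(N;m,c_2)$ for every $N\ge1$.
   Context: For a monic $m\in\mathbb{F}_p[T]$ and $c$ coprime to $m$, $\pi(N;m,c)$ denotes the number of monic irreducible polynomials in $\mathbb{F}_p[T]$ of degree $N$ that are congruent to $c$ modulo $m$. -}

module Defs where

open import Data.Nat using (ℕ; zero; suc; _+_; _*_; _∸_; _≤_)
open import Data.Nat.DivMod using (_%_)
open import Data.Nat.Properties using () renaming (_≟_ to _≟ℕ_)
open import Data.Bool using (Bool; true; false; _∧_; _∨_; not; if_then_else_)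
open import Data.List using (List; []; _∷_; _++_; map; foldr; foldl; reverse; length; replicate; concatMap; upTo; null; zipWith)
open import Data.Bool.ListAction using (any)
open import Data.List.Properties using (≡-dec)
open import Data.Product using (Σ; ∃; _,_)
open import Relation.Nullary using (does)
open import Relation.Binary.PropositionalEquality using (_≡_)

-- Polynomials in F_p[T] are represented by coefficient lists (lowest degree
-- first) of natural numbers; the coefficient n stands for the class of n in F_p.
-- All ring operations are first carried out over ℕ and only then reduced mod p
-- (this is legitimate since ℕ → F_p is a semiring homomorphism).
Poly : Set
Poly = List ℕ

modP : ℕ → ℕ → ℕ
modP zero    x = x
modP (suc q) x = x % suc q

cons0 : ℕ → List ℕ → List ℕ
cons0 zero [] = []
cons0 x    ys = x ∷ ys

-- normal form in F_p[T]: reduce coefficients mod p, strip trailing zeros.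
-- Two representatives denote the same element of F_p[T] iff their normal forms agree.
normP : ℕ → Poly → Poly
normP p []       = []
normP p (x ∷ xs) = cons0 (modP p x) (normP p xs)

_≈[_]_ : Poly → ℕ → Poly → Set
f ≈[ p ] g = normP p f ≡ normP p g

addP : Poly → Poly → Poly
addP []       g        = g
addP f        []       = f
addP (x ∷ xs) (y ∷ ys) = (x + y) ∷ addP xs ys

mulP : Poly → Poly → Poly
mulP []       g = []
mulP (a ∷ f) g = addP (map (a *_) g) (0 ∷ mulP f g)

-- additive inverse in F_p[T]: -c = (p-1)·c
negP : ℕ → Poly → Poly
negP p f = map ((p ∸ 1) *_) f

subP : ℕ → Poly → Poly → Poly
subP p f g = addP f (negP p g)

TPow : ℕ → Poly
TPow k = replicate k 0 ++ (1 ∷ [])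

constP : ℕ → Poly
constP a = a ∷ []

mPoly : ℕ → ℕ → Poly
mPoly p a = subP p (subP p (TPow p) (TPow 1)) (constP a)

-- c(T + b), computed by Horner's scheme
shiftP : ℕ → Poly → Poly
shiftP b c = foldr (λ coef acc → addP (constP coef) (mulP (b ∷ 1 ∷ []) acc)) [] c

-- degree-related notions (on normal forms)
-- number of coefficients of the normal form = deg + 1 (0 for the zero polynomial)
sizeP : ℕ → Poly → ℕ
sizeP p f = length (normP p f)

Divides : ℕ → Poly → Poly → Set
Divides p d g = ∃ λ q → g ≈[ p ] mulP d q

-- units of F_p[T] are exactly the nonzero constants (degree 0)
IsUnit : ℕ → Poly → Set
IsUnit p u = sizeP p u ≡ 1

Coprime : ℕ → Poly → Poly → Set
Coprime p c m = ∀ d → Divides p d c → Divides p d m → IsUnit p d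

CongMod : ℕ → Poly → Poly → Poly → Set
CongMod p f g m = Divides p m (subP p f g)

eqB : Poly → Poly → Bool
eqB f g = does (≡-dec _≟ℕ_ f g)

headOr : List ℕ → ℕ
headOr []      = 0
headOr (x ∷ _) = x

tailL : List ℕ → List ℕ
tailL []       = []
tailL (_ ∷ xs) = xs

initL : List ℕ → List ℕ
initL []           = []
initL (x ∷ [])     = []
initL (x ∷ y ∷ ys) = x ∷ initL (y ∷ ys)

-- remainder of g upon division by a MONIC polynomial m (schoolbook long
-- division; no inverses needed since m is monic).  The running remainder r
-- is kept high-to-low with exactly deg m coefficients.
remMonic : ℕ → Poly → Poly → Poly
remMonic p m g = normP p (reverse (foldl step (replicate d 0) (reverse (normP p g))))
  where
  mhigh : List ℕ
  mhigh = reverse (initL (normP p m))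
  d : ℕ
  d = length mhigh
  step : List ℕ → ℕ → List ℕ
  step r c = let s = r ++ (c ∷ []) ; top = headOr s in
             map (modP p) (zipWith (λ x y → x + (p ∸ 1) * top * y) (tailL s) mhigh)

-- m ∣ g, decided via the remainder (valid for monic m)
dvdMonicB : ℕ → Poly → Poly → Bool
dvdMonicB p m g = null (remMonic p m g)

congMonicB : ℕ → Poly → Poly → Poly → Bool
congMonicB p f c m = dvdMonicB p m (subP p f c)

vecsP : ℕ → ℕ → List Poly
vecsP p zero    = [] ∷ []
vecsP p (suc n) = concatMap (λ x → map (x ∷_) (vecsP p n)) (upTo p)

monicsP : ℕ → ℕ → List Poly
monicsP p N = map (_++ (1 ∷ [])) (vecsP p N)

posDegB : ℕ → Poly → Bool
posDegB p g = not (sizeP p g Data.Nat.≤ᵇ 1)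

-- f of degree N is irreducible: deg f ≥ 1 and f is not a product g·h of two
-- polynomials of positive degree.  Such factors automatically have degree
-- ≤ N-1, i.e. are represented by coefficient lists of length N, so the
-- search below is exhaustive.
irredB : ℕ → ℕ → Poly → Bool
irredB p N f = not (N Data.Nat.≤ᵇ 0) ∧
  not (any (λ g → any (λ h → posDegB p g ∧ posDegB p h ∧ eqB (normP p (mulP g h)) (normP p f))
                      (vecsP p N))
           (vecsP p N))

countB : {A : Set} → (A → Bool) → List A → ℕ
countB P []       = 0
countB P (x ∷ xs) = (if P x then 1 else 0) + countB P xs

-- π(N; m, c): number of monic irreducible f ∈ F_p[T] of degree N with f ≡ c (mod m)
-- (m assumed monic)
πP : ℕ → ℕ → Poly → Poly → ℕ
πP p N m c = countB (λ f → irredB p N f ∧ congMonicB p f c m) (monicsP p N)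

-- Substitution σ_b : f(T) ↦ f(T + b) is a ring automorphism of 𝔽ₚ[T], with inverse σ_{p-b}, that
-- preserves degree and leading coefficient; hence it permutes the monic polynomials of degree N and
-- preserves irreducibility. By the Frobenius identity (T + b)^p = T^p + b^p = T^p + b it fixes
-- m = T^p - T - a, so f ≡ c₁ (mod m) iff σ_b f ≡ c₁(T + b) ≡ c₂ (mod m). Thus σ_b maps the
-- polynomials counted by π(N; m, c₁) bijectively onto those counted by π(N; m, c₂).

module Submission where

open import Defs
open import Data.Nat using (ℕ; suc; _<_; _≤_)
import Data.Nat as ℕ
import Data.Nat.Properties as ℕ
open import Data.Nat.DivMod using (_%_; n%n≡0)
open import Data.Nat.Primality using (Prime)
open import Data.Bool using (Bool; _∧_)
open import Data.List using (List; map; _∷ʳ_)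
import Relation.Binary.PropositionalEquality as ≡
open ≡ using (_≡_)
open import Algebra.Bundles using (CommutativeSemiring)

module PrimeBinomial where

  open import Data.Nat using (zero; suc; _*_; _∸_; _≤_; _<_; _!)
  open import Data.Nat.Properties using (m≤n⇒m≤1+n; <⇒≤; <⇒≱; ∸-monoʳ-<; _!*_!≢0)
  open import Data.Nat.DivMod using (m/n*n≡m)
  open import Data.Nat.Divisibility using (_∣_; ∣⇒≤; ∣1⇒≡1; m∣m*n)
  open import Data.Nat.Primality using (Prime; euclidsLemma; ¬prime[1])
  open import Data.Nat.Combinatorics using (_C_; nCk≡n!/k![n-k]!; k![n∸k]!∣n!)
  open import Data.Sum using (inj₁; inj₂)
  open import Data.Empty using (⊥-elim)
  open import Relation.Binary.PropositionalEquality using (_≡_; sym; trans; cong; subst)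

  prime∣!⇒≤ : ∀ {p} → Prime p → ∀ n → p ∣ n ! → p ≤ n
  prime∣!⇒≤ p-prime zero    p∣1 = ⊥-elim (¬prime[1] (subst Prime (∣1⇒≡1 p∣1) p-prime))
  prime∣!⇒≤ p-prime (suc n) p∣n! with euclidsLemma (suc n) (n !) p-prime p∣n!
  ... | inj₁ p∣1+n = ∣⇒≤ p∣1+n
  ... | inj₂ p∣n!  = m≤n⇒m≤1+n (prime∣!⇒≤ p-prime n p∣n!)

  -- p! = (p C k) · k! · (p-k)!, and p divides neither k! nor (p-k)! since k, p-k < p.
  prime∣C : ∀ {p k} → Prime p → 0 < k → k < p → p ∣ p C k
  prime∣C {p@(suc p-1)} {k} p-prime 0<k k<p
    with euclidsLemma (p C k) (k ! * (p ∸ k) !) p-prime p∣C*k!*[p-k]!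
    where
    instance _ = k !* (p ∸ k) !≢0
    C*k!*[p-k]!≡p! : (p C k) * (k ! * (p ∸ k) !) ≡ p !
    C*k!*[p-k]!≡p! =
      trans (cong (_* (k ! * (p ∸ k) !)) (nCk≡n!/k![n-k]! (<⇒≤ k<p))) (m/n*n≡m (k![n∸k]!∣n! (<⇒≤ k<p)))
    p∣C*k!*[p-k]! : p ∣ (p C k) * (k ! * (p ∸ k) !)
    p∣C*k!*[p-k]! = subst (p ∣_) (sym C*k!*[p-k]!≡p!) (m∣m*n (p-1 !))
  ... | inj₁ p∣C = p∣C
  ... | inj₂ p∣k!*[p-k]! with euclidsLemma (k !) ((p ∸ k) !) p-prime p∣k!*[p-k]!
  ...   | inj₁ p∣k!     = ⊥-elim (<⇒≱ k<p (prime∣!⇒≤ p-prime k p∣k!))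
  ...   | inj₂ p∣[p-k]! = ⊥-elim (<⇒≱ (∸-monoʳ-< {p} 0<k (<⇒≤ k<p)) (prime∣!⇒≤ p-prime (p ∸ k) p∣[p-k]!))

module Frobenius {c ℓ} (S : CommutativeSemiring c ℓ) where

  open import Data.Nat as ℕ using (ℕ; zero; suc; _∸_; _<_; s≤s; z≤n)
  import Data.Nat.Properties as ℕ
  open import Data.Nat.Divisibility using (_∣_; divides)
  open import Data.Nat.Primality using (Prime)
  open import Data.Nat.Combinatorics using (_C_; nCn≡1)
  open import Data.Fin using (Fin; zero; suc; toℕ; fromℕ; inject₁)
  open import Data.Fin.Properties using (toℕ-fromℕ; toℕ-inject₁; toℕ<n)
  open import Data.Vec.Functional using (init; last; tail)
  open import Relation.Binary.PropositionalEquality as ≡ using (_≡_)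
  open PrimeBinomial
  open CommutativeSemiring S hiding (zero)
  open import Algebra.Properties.Semiring.Mult semiring using (_×_; ×-cong; ×-congˡ; ×-assocˡ)
  open import Algebra.Properties.Semiring.Exp semiring using (_^_; ^-congʳ)
  open import Algebra.Properties.Monoid.Sum +-monoid
    using (sum; sum-cong-≋; sum-init-last; sum-replicate-zero)
  open import Algebra.Properties.CommutativeSemiring.Binomial S using (theorem; binomialTerm)
  open import Relation.Binary.Reasoning.Setoid setoid

  CharDivides : ℕ → Set _
  CharDivides p = ∀ x → p × x ≈ 0#

  multiple×-vanishes : ∀ {p n} → CharDivides p → p ∣ n → ∀ x → n × x ≈ 0#
  multiple×-vanishes {p} char (divides q ≡.refl) x = begin
    (q ℕ.* p) × x ≈⟨ ×-congˡ (ℕ.*-comm q p) ⟩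
    (p ℕ.* q) × x ≈⟨ ×-assocˡ x p q ⟨
    p × (q × x)   ≈⟨ char (q × x) ⟩
    0#            ∎

  freshmansDream : ∀ {p} → Prime p → CharDivides p → ∀ x y → (x + y) ^ p ≈ x ^ p + y ^ p
  freshmansDream {p@(suc (suc r))} p-prime char x y = begin
    (x + y) ^ p                                     ≈⟨ theorem p x y ⟩
    t zero + sum (tail t)                           ≈⟨ +-congˡ (sum-init-last (tail t)) ⟩
    t zero + (sum (init (tail t)) + last (tail t))  ≈⟨ +-cong first (+-cong middle final) ⟩
    y ^ p + (0# + x ^ p)                            ≈⟨ +-congˡ (+-identityˡ (x ^ p)) ⟩
    y ^ p + x ^ p                                   ≈⟨ +-comm (y ^ p) (x ^ p) ⟩
    x ^ p + y ^ p                                   ∎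
    where
    t = binomialTerm x y p
    first : t zero ≈ y ^ p
    first = trans (+-identityʳ _) (*-identityˡ _)
    middle : sum (init (tail t)) ≈ 0#
    middle = trans (sum-cong-≋ vanishes) (sum-replicate-zero (suc r))
      where
      vanishes : ∀ k → init (tail t) k ≈ 0#
      vanishes k = multiple×-vanishes char (prime∣C p-prime (s≤s z≤n) (s≤s (s≤s k≤r))) _
        where
        k≤r : toℕ (inject₁ k) ℕ.≤ r
        k≤r = ℕ.≤-trans (ℕ.≤-reflexive (toℕ-inject₁ k)) (ℕ.s≤s⁻¹ (toℕ<n k))
    final : last (tail t) ≈ x ^ p
    final = begin
      (p C toℕ (fromℕ p)) × (x ^ toℕ (fromℕ p) * y ^ (p ∸ toℕ (fromℕ p)))
        ≈⟨ ×-cong (≡.trans (≡.cong (p C_) (toℕ-fromℕ p)) (nCn≡1 p))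
                  (*-cong (^-congʳ x (toℕ-fromℕ p)) (^-congʳ y (≡.trans (≡.cong (p ∸_) (toℕ-fromℕ p)) (ℕ.n∸n≡0 p)))) ⟩
      1 × (x ^ p * 1#)  ≈⟨ +-identityʳ _ ⟩
      x ^ p * 1#        ≈⟨ *-identityʳ _ ⟩
      x ^ p             ∎

  1#^n≈1# : ∀ n → 1# ^ n ≈ 1#
  1#^n≈1# zero    = refl
  1#^n≈1# (suc n) = trans (*-identityˡ (1# ^ n)) (1#^n≈1# n)

  fermat : ∀ {p} → Prime p → CharDivides p → ∀ n → (n × 1#) ^ p ≈ n × 1#
  fermat {suc q} p-prime char zero    = zeroˡ (0# ^ q)
  fermat {p}     p-prime char (suc n) = begin
    (1# + n × 1#) ^ p       ≈⟨ freshmansDream p-prime char 1# (n × 1#) ⟩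
    1# ^ p + (n × 1#) ^ p   ≈⟨ +-cong (1#^n≈1# p) (fermat p-prime char n) ⟩
    1# + n × 1#             ∎

module Counting {A : Set} where

  open import Data.Nat using (_+_)
  open import Data.Bool using (Bool; if_then_else_)
  open import Data.List using (List; []; _∷_; map)
  open import Data.List.Properties using (map-∘; map-id-local)
  open import Data.List.Membership.Propositional using (_∈_)
  open import Data.List.Membership.Propositional.Properties using (∈-map⁺; ∈-map⁻)
  open import Data.List.Membership.Propositional.Properties.WithK using (unique∧set⇒bag)
  open import Data.List.Relation.Unary.All using (tabulate)
  open import Data.List.Relation.Unary.Unique.Propositional using (Unique)
  import Data.List.Relation.Unary.Unique.Propositional.Properties as Unique
  open import Data.List.Relation.Binary.Permutation.Propositional using (_↭_; refl; prep; swap; trans)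
  open import Data.List.Relation.Binary.BagAndSetEquality using (∼bag⇒↭)
  open import Data.Nat.Properties using (+-assoc; +-comm)
  open import Data.Product using (_,_)
  open import Function.Bundles using (mk⇔)
  open import Relation.Binary.PropositionalEquality as ≡ using (_≡_; cong; cong₂; subst)

  countB-↭ : ∀ (P : A → Bool) {xs ys} → xs ↭ ys → countB P xs ≡ countB P ys
  countB-↭ P refl                  = ≡.refl
  countB-↭ P (prep x xs↭ys)        = cong ((if P x then 1 else 0) +_) (countB-↭ P xs↭ys)
  countB-↭ P (swap {xs} {ys} x y xs↭ys) = ≡.trans (≡.sym (+-assoc [x] [y] (countB P xs)))
    (≡.trans (cong₂ _+_ (+-comm [x] [y]) (countB-↭ P xs↭ys)) (+-assoc [y] [x] (countB P ys)))
    where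
    [x] = if P x then 1 else 0
    [y] = if P y then 1 else 0
  countB-↭ P (trans xs↭ys ys↭zs)   = ≡.trans (countB-↭ P xs↭ys) (countB-↭ P ys↭zs)

  countB-map : ∀ {B : Set} (P : A → Bool) (f : B → A) xs → countB P (map f xs) ≡ countB (λ x → P (f x)) xs
  countB-map P f []       = ≡.refl
  countB-map P f (x ∷ xs) = cong ((if P (f x) then 1 else 0) +_) (countB-map P f xs)

  countB-cong : ∀ {P Q : A → Bool} → (∀ x → P x ≡ Q x) → ∀ xs → countB P xs ≡ countB Q xs
  countB-cong P≡Q []       = ≡.refl
  countB-cong P≡Q (x ∷ xs) = cong₂ (λ b n → (if b then 1 else 0) + n) (P≡Q x) (countB-cong P≡Q xs)

  -- Duplicate-free lists with the same elements are bag equal.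
  map-↭ : ∀ {f g : A → A} {xs} → Unique xs →
          (∀ {x} → x ∈ xs → f x ∈ xs) → (∀ {x} → x ∈ xs → g x ∈ xs) →
          (∀ {x} → x ∈ xs → g (f x) ≡ x) → (∀ {x} → x ∈ xs → f (g x) ≡ x) →
          map f xs ↭ xs
  map-↭ {f} {g} {xs} xs! f∈ g∈ g∘f≡id f∘g≡id = ∼bag⇒↭ (unique∧set⇒bag fxs! xs! (mk⇔ to from))
    where
    gfxs≡xs : map g (map f xs) ≡ xs
    gfxs≡xs = ≡.trans (≡.sym (map-∘ xs)) (map-id-local (tabulate g∘f≡id))
    fxs! : Unique (map f xs)
    fxs! = Unique.map⁻ (subst Unique (≡.sym gfxs≡xs) xs!)
    to : ∀ {z} → z ∈ map f xs → z ∈ xs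
    to z∈ with ∈-map⁻ f z∈
    ... | x , x∈ , ≡.refl = f∈ x∈
    from : ∀ {z} → z ∈ xs → z ∈ map f xs
    from z∈ = subst (_∈ map f xs) (f∘g≡id z∈) (∈-map⁺ f (g∈ z∈))

module BooleanTests where

  open import Data.Bool using (true; false; T)
  open import Data.Empty using (⊥-elim)
  open import Data.List.Properties using (≡-dec)
  import Data.Nat as ℕ
  open import Relation.Nullary using (yes; no)
  open import Relation.Binary.PropositionalEquality using (_≡_; refl)

  T-⇔⇒≡ : ∀ {x y} → (T x → T y) → (T y → T x) → x ≡ y
  T-⇔⇒≡ {false} {false} _ _ = refl
  T-⇔⇒≡ {false} {true}  _ y⇒x = ⊥-elim (y⇒x _)
  T-⇔⇒≡ {true}  {false} x⇒y _ = ⊥-elim (x⇒y _)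
  T-⇔⇒≡ {true}  {true}  _ _ = refl

  T-eqB⁻ : ∀ {f g} → T (eqB f g) → f ≡ g
  T-eqB⁻ {f} {g} with ≡-dec ℕ._≟_ f g
  ... | yes f≡g = λ _ → f≡g
  ... | no _    = λ ()

  T-eqB⁺ : ∀ {f g} → f ≡ g → T (eqB f g)
  T-eqB⁺ {f} {g} f≡g with ≡-dec ℕ._≟_ f g
  ... | yes _  = _
  ... | no f≢g = f≢g f≡g

module ExactArithmetic where

  open import Data.Nat using (ℕ; zero; suc; _+_; _*_)
  open import Data.Nat.Properties
    using (+-identityʳ; +-comm; +-assoc; *-zeroʳ; *-identityˡ; *-comm)
  open import Data.Nat.Tactic.RingSolver using (solve-∀)
  open import Data.List using (List; []; _∷_; map; length; _∷ʳ_; _++_; replicate)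
  open import Relation.Binary.Bundles using (Setoid)
  open import Relation.Binary.PropositionalEquality
    using (_≡_; refl; sym; trans; cong; cong₂; module ≡-Reasoning)
  import Relation.Binary.Reasoning.Setoid as SetoidReasoning

  coeff : Poly → ℕ → ℕ
  coeff []      i       = 0
  coeff (x ∷ f) zero    = x
  coeff (x ∷ f) (suc i) = coeff f i

  infix 4 _≋_
  record _≋_ (f g : Poly) : Set where
    constructor mk≋
    field ≋-coeff : ∀ i → coeff f i ≡ coeff g i
  open _≋_ public

  ≋-refl : ∀ {f} → f ≋ f
  ≋-refl = mk≋ λ _ → refl

  ≋-sym : ∀ {f g} → f ≋ g → g ≋ f
  ≋-sym f≋g = mk≋ λ i → sym (≋-coeff f≋g i)

  ≋-trans : ∀ {f g h} → f ≋ g → g ≋ h → f ≋ h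
  ≋-trans f≋g g≋h = mk≋ λ i → trans (≋-coeff f≋g i) (≋-coeff g≋h i)

  ≋-setoid : Setoid _ _
  ≋-setoid = record { Carrier = Poly ; _≈_ = _≋_
                    ; isEquivalence = record { refl = ≋-refl ; sym = ≋-sym ; trans = ≋-trans } }

  module ≋-Reasoning = SetoidReasoning ≋-setoid

  coeff-addP : ∀ f g i → coeff (addP f g) i ≡ coeff f i + coeff g i
  coeff-addP []      g       i       = refl
  coeff-addP (x ∷ f) []      i       = sym (+-identityʳ _)
  coeff-addP (x ∷ f) (y ∷ g) zero    = refl
  coeff-addP (x ∷ f) (y ∷ g) (suc i) = coeff-addP f g i

  coeff-scale : ∀ a g i → coeff (map (a *_) g) i ≡ a * coeff g i
  coeff-scale a []      i       = sym (*-zeroʳ a)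
  coeff-scale a (x ∷ g) zero    = refl
  coeff-scale a (x ∷ g) (suc i) = coeff-scale a g i

  coeff-mulP-∷ : ∀ a f g i → coeff (mulP (a ∷ f) g) i ≡ a * coeff g i + coeff (0 ∷ mulP f g) i
  coeff-mulP-∷ a f g i =
    trans (coeff-addP (map (a *_) g) (0 ∷ mulP f g) i) (cong (_+ _) (coeff-scale a g i))

  coeff-[0] : ∀ i → coeff (0 ∷ []) i ≡ 0
  coeff-[0] zero    = refl
  coeff-[0] (suc i) = refl

  coeff-∷ʳ : ∀ xs y → coeff (xs ∷ʳ y) (length xs) ≡ y
  coeff-∷ʳ []       y = refl
  coeff-∷ʳ (x ∷ xs) y = coeff-∷ʳ xs y

  coeff-replicate-0 : ∀ k i → coeff (replicate k 0) i ≡ 0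
  coeff-replicate-0 zero    i       = refl
  coeff-replicate-0 (suc k) zero    = refl
  coeff-replicate-0 (suc k) (suc i) = coeff-replicate-0 k i

  ∷-cong≋ : ∀ {x y f g} → x ≡ y → f ≋ g → x ∷ f ≋ y ∷ g
  ∷-cong≋ x≡y f≋g = mk≋ λ { zero → x≡y ; (suc i) → ≋-coeff f≋g i }

  ++-replicate-0 : ∀ w k → w ++ replicate k 0 ≋ w
  ++-replicate-0 []      k = mk≋ (coeff-replicate-0 k)
  ++-replicate-0 (x ∷ w) k = ∷-cong≋ refl (++-replicate-0 w k)

  addP-cong≋ : ∀ {f f' g g'} → f ≋ f' → g ≋ g' → addP f g ≋ addP f' g'
  addP-cong≋ {f} {f'} {g} {g'} f≋f' g≋g' = mk≋ λ i →
    trans (coeff-addP f g i) (trans (cong₂ _+_ (≋-coeff f≋f' i) (≋-coeff g≋g' i)) (sym (coeff-addP f' g' i)))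

  addP-comm : ∀ f g → addP f g ≋ addP g f
  addP-comm f g = mk≋ λ i →
    trans (coeff-addP f g i) (trans (+-comm (coeff f i) (coeff g i)) (sym (coeff-addP g f i)))

  addP-assoc : ∀ f g h → addP (addP f g) h ≋ addP f (addP g h)
  addP-assoc f g h = mk≋ λ i → begin
    coeff (addP (addP f g) h) i               ≡⟨ coeff-addP (addP f g) h i ⟩
    coeff (addP f g) i + coeff h i            ≡⟨ cong (_+ coeff h i) (coeff-addP f g i) ⟩
    coeff f i + coeff g i + coeff h i         ≡⟨ +-assoc (coeff f i) _ _ ⟩
    coeff f i + (coeff g i + coeff h i)       ≡⟨ cong (coeff f i +_) (coeff-addP g h i) ⟨
    coeff f i + coeff (addP g h) i            ≡⟨ coeff-addP f (addP g h) i ⟨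
    coeff (addP f (addP g h)) i               ∎
    where open ≡-Reasoning

  addP-identityʳ : ∀ f → addP f [] ≋ f
  addP-identityʳ f = mk≋ λ i → trans (coeff-addP f [] i) (+-identityʳ _)

  addP-[0]ʳ : ∀ f → addP f (0 ∷ []) ≋ f
  addP-[0]ʳ f = mk≋ λ i → trans (coeff-addP f (0 ∷ []) i) (trans (cong (coeff f i +_) (coeff-[0] i)) (+-identityʳ _))

  mulP-0∷ : ∀ f g → mulP (0 ∷ f) g ≋ 0 ∷ mulP f g
  mulP-0∷ f g = mk≋ (coeff-mulP-∷ 0 f g)

  mulP-identityˡ : ∀ f → mulP (1 ∷ []) f ≋ f
  mulP-identityˡ f = ≋-trans (addP-[0]ʳ (map (1 *_) f)) (mk≋ λ i → trans (coeff-scale 1 f i) (*-identityˡ _))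

  mulP-zeroʳ : ∀ f → mulP f [] ≋ []
  mulP-zeroʳ []      = ≋-refl
  mulP-zeroʳ (a ∷ f) = mk≋ λ i → begin
    coeff (mulP (a ∷ f) []) i        ≡⟨ coeff-mulP-∷ a f [] i ⟩
    a * 0 + coeff (0 ∷ mulP f []) i  ≡⟨ cong₂ _+_ (*-zeroʳ a) (≋-coeff (∷-cong≋ refl (mulP-zeroʳ f)) i) ⟩
    coeff (0 ∷ []) i                 ≡⟨ coeff-[0] i ⟩
    0                                ∎
    where open ≡-Reasoning

  mulP-distribʳ : ∀ f g h → mulP (addP f g) h ≋ addP (mulP f h) (mulP g h)
  mulP-distribʳ []      g       h = ≋-refl
  mulP-distribʳ (x ∷ f) []      h = ≋-sym (addP-identityʳ _)
  mulP-distribʳ (x ∷ f) (y ∷ g) h = mk≋ λ i → begin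
    coeff (mulP (x + y ∷ addP f g) h) i
      ≡⟨ coeff-mulP-∷ (x + y) (addP f g) h i ⟩
    (x + y) * coeff h i + coeff (0 ∷ mulP (addP f g) h) i
      ≡⟨ cong ((x + y) * coeff h i +_) (≋-coeff (∷-cong≋ refl (mulP-distribʳ f g h)) i) ⟩
    (x + y) * coeff h i + coeff (0 ∷ addP (mulP f h) (mulP g h)) i
      ≡⟨ cong ((x + y) * coeff h i +_) (coeff-addP (0 ∷ mulP f h) (0 ∷ mulP g h) i) ⟩
    (x + y) * coeff h i + (coeff (0 ∷ mulP f h) i + coeff (0 ∷ mulP g h) i)
      ≡⟨ regroup x y (coeff h i) _ _ ⟩
    (x * coeff h i + coeff (0 ∷ mulP f h) i) + (y * coeff h i + coeff (0 ∷ mulP g h) i)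
      ≡⟨ cong₂ _+_ (coeff-mulP-∷ x f h i) (coeff-mulP-∷ y g h i) ⟨
    coeff (mulP (x ∷ f) h) i + coeff (mulP (y ∷ g) h) i
      ≡⟨ coeff-addP (mulP (x ∷ f) h) (mulP (y ∷ g) h) i ⟨
    coeff (addP (mulP (x ∷ f) h) (mulP (y ∷ g) h)) i ∎
    where
    open ≡-Reasoning
    regroup : ∀ x y c u v → (x + y) * c + (u + v) ≡ (x * c + u) + (y * c + v)
    regroup = solve-∀

  scale-mulP : ∀ a g h → mulP (map (a *_) g) h ≋ map (a *_) (mulP g h)
  scale-mulP a []      h = ≋-refl
  scale-mulP a (x ∷ g) h = mk≋ λ i → begin
    coeff (mulP (a * x ∷ map (a *_) g) h) i
      ≡⟨ coeff-mulP-∷ (a * x) (map (a *_) g) h i ⟩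
    a * x * coeff h i + coeff (0 ∷ mulP (map (a *_) g) h) i
      ≡⟨ cong (a * x * coeff h i +_) (≋-coeff (∷-cong≋ (sym (*-zeroʳ a)) (scale-mulP a g h)) i) ⟩
    a * x * coeff h i + coeff (map (a *_) (0 ∷ mulP g h)) i
      ≡⟨ cong (a * x * coeff h i +_) (coeff-scale a (0 ∷ mulP g h) i) ⟩
    a * x * coeff h i + a * coeff (0 ∷ mulP g h) i
      ≡⟨ factor a x (coeff h i) _ ⟩
    a * (x * coeff h i + coeff (0 ∷ mulP g h) i)
      ≡⟨ cong (a *_) (coeff-mulP-∷ x g h i) ⟨
    a * coeff (mulP (x ∷ g) h) i
      ≡⟨ coeff-scale a (mulP (x ∷ g) h) i ⟨
    coeff (map (a *_) (mulP (x ∷ g) h)) i ∎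
    where
    open ≡-Reasoning
    factor : ∀ a x c u → a * x * c + a * u ≡ a * (x * c + u)
    factor = solve-∀

  mulP-∷ʳ : ∀ f b g → mulP f (b ∷ g) ≋ addP (map (b *_) f) (0 ∷ mulP f g)
  mulP-∷ʳ []      b g = mk≋ λ i → sym (coeff-[0] i)
  mulP-∷ʳ (a ∷ f) b g = ∷-cong≋ (trans (+-identityʳ _) (trans (*-comm a b) (sym (+-identityʳ _)))) (begin
    addP ag (mulP f (b ∷ g))                 ≈⟨ addP-cong≋ (≋-refl {ag}) (mulP-∷ʳ f b g) ⟩
    addP ag (addP bf (0 ∷ mulP f g))         ≈⟨ addP-assoc ag bf _ ⟨
    addP (addP ag bf) (0 ∷ mulP f g)         ≈⟨ addP-cong≋ (addP-comm ag bf) (≋-refl {0 ∷ mulP f g}) ⟩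
    addP (addP bf ag) (0 ∷ mulP f g)         ≈⟨ addP-assoc bf ag _ ⟩
    addP bf (addP ag (0 ∷ mulP f g))         ∎)
    where
    open ≋-Reasoning
    ag = map (a *_) g
    bf = map (b *_) f

  mulP-comm : ∀ f g → mulP f g ≋ mulP g f
  mulP-comm []      g = ≋-sym (mulP-zeroʳ g)
  mulP-comm (a ∷ f) g =
    ≋-sym (≋-trans (mulP-∷ʳ g a f) (addP-cong≋ (≋-refl {map (a *_) g}) (∷-cong≋ refl (mulP-comm g f))))

  mulP-assoc : ∀ f g h → mulP (mulP f g) h ≋ mulP f (mulP g h)
  mulP-assoc []      g h = ≋-refl
  mulP-assoc (a ∷ f) g h = begin
    mulP (addP (map (a *_) g) (0 ∷ mulP f g)) h
      ≈⟨ mulP-distribʳ (map (a *_) g) (0 ∷ mulP f g) h ⟩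
    addP (mulP (map (a *_) g) h) (mulP (0 ∷ mulP f g) h)
      ≈⟨ addP-cong≋ (scale-mulP a g h) (mulP-0∷ (mulP f g) h) ⟩
    addP (map (a *_) (mulP g h)) (0 ∷ mulP (mulP f g) h)
      ≈⟨ addP-cong≋ (≋-refl {map (a *_) (mulP g h)}) (∷-cong≋ refl (mulP-assoc f g h)) ⟩
    addP (map (a *_) (mulP g h)) (0 ∷ mulP f (mulP g h)) ∎
    where open ≋-Reasoning

module ModularArithmetic (r : ℕ) where

  open import Data.Nat as ℕ using (ℕ; zero; suc)
  open import Data.Nat.Properties using (*-zeroʳ)
  open import Data.Nat.DivMod using (_%_; %-distribˡ-+; %-distribˡ-*)
  open import Data.List using ([]; _∷_; map)
  open import Data.Product using (_,_)
  open import Algebra.Structures.Biased using (isCommutativeSemiringˡ)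
  open import Relation.Binary.Structures using (IsEquivalence)
  open import Relation.Binary.PropositionalEquality using (_≡_; refl; sym; trans; cong; cong₂)
  open ExactArithmetic

  -- p = r + 2 rather than an arbitrary p ≥ 2, so that modP p and _% p compute.
  p : ℕ
  p = suc (suc r)

  +-cong-mod : ∀ {a a' b b'} → a % p ≡ a' % p → b % p ≡ b' % p → (a ℕ.+ b) % p ≡ (a' ℕ.+ b') % p
  +-cong-mod {a} {a'} {b} {b'} a≡a' b≡b' =
    trans (%-distribˡ-+ a b p) (trans (cong₂ (λ x y → (x ℕ.+ y) % p) a≡a' b≡b') (sym (%-distribˡ-+ a' b' p)))

  *-cong-mod : ∀ {a a' b b'} → a % p ≡ a' % p → b % p ≡ b' % p → (a ℕ.* b) % p ≡ (a' ℕ.* b') % p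
  *-cong-mod {a} {a'} {b} {b'} a≡a' b≡b' =
    trans (%-distribˡ-* a b p) (trans (cong₂ (λ x y → (x ℕ.* y) % p) a≡a' b≡b') (sym (%-distribˡ-* a' b' p)))

  [a*x+y]%p≡y%p : ∀ a {x} y → x % p ≡ 0 → (a ℕ.* x ℕ.+ y) % p ≡ y % p
  [a*x+y]%p≡y%p a {x} y x≡0 =
    +-cong-mod {a ℕ.* x} {0} {y} {y} (trans (*-cong-mod {a} {a} {x} {0} refl x≡0) (cong (_% p) (*-zeroʳ a))) refl

  infix 4 _≈ₚ_
  record _≈ₚ_ (f g : Poly) : Set where
    constructor mk≈ₚ
    field ≈ₚ-coeff : ∀ i → coeff f i % p ≡ coeff g i % p
  open _≈ₚ_ public

  ≈ₚ-refl : ∀ {f} → f ≈ₚ f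
  ≈ₚ-refl = mk≈ₚ λ _ → refl

  ≈ₚ-sym : ∀ {f g} → f ≈ₚ g → g ≈ₚ f
  ≈ₚ-sym f≈g = mk≈ₚ λ i → sym (≈ₚ-coeff f≈g i)

  ≈ₚ-trans : ∀ {f g h} → f ≈ₚ g → g ≈ₚ h → f ≈ₚ h
  ≈ₚ-trans f≈g g≈h = mk≈ₚ λ i → trans (≈ₚ-coeff f≈g i) (≈ₚ-coeff g≈h i)

  ≈ₚ-reflexive : ∀ {f g} → f ≡ g → f ≈ₚ g
  ≈ₚ-reflexive refl = ≈ₚ-refl

  ≈ₚ-isEquivalence : IsEquivalence _≈ₚ_
  ≈ₚ-isEquivalence = record { refl = ≈ₚ-refl ; sym = ≈ₚ-sym ; trans = ≈ₚ-trans }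

  ≋⇒≈ₚ : ∀ {f g} → f ≋ g → f ≈ₚ g
  ≋⇒≈ₚ f≋g = mk≈ₚ λ i → cong (_% p) (≋-coeff f≋g i)

  ∷-cong : ∀ {x y f g} → x % p ≡ y % p → f ≈ₚ g → x ∷ f ≈ₚ y ∷ g
  ∷-cong x≡y f≈g = mk≈ₚ λ { zero → x≡y ; (suc i) → ≈ₚ-coeff f≈g i }

  tailL-cong : ∀ {f g} → f ≈ₚ g → tailL f ≈ₚ tailL g
  tailL-cong {[]}    {[]}    f≈g = f≈g
  tailL-cong {[]}    {_ ∷ _} f≈g = mk≈ₚ λ i → ≈ₚ-coeff f≈g (suc i)
  tailL-cong {_ ∷ _} {[]}    f≈g = mk≈ₚ λ i → ≈ₚ-coeff f≈g (suc i)
  tailL-cong {_ ∷ _} {_ ∷ _} f≈g = mk≈ₚ λ i → ≈ₚ-coeff f≈g (suc i)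

  addP-cong : ∀ {f f' g g'} → f ≈ₚ f' → g ≈ₚ g' → addP f g ≈ₚ addP f' g'
  addP-cong {f} {f'} {g} {g'} f≈f' g≈g' = mk≈ₚ λ i →
    trans (cong (_% p) (coeff-addP f g i))
      (trans (+-cong-mod {coeff f i} {coeff f' i} {coeff g i} {coeff g' i} (≈ₚ-coeff f≈f' i) (≈ₚ-coeff g≈g' i))
        (cong (_% p) (sym (coeff-addP f' g' i))))

  scale-cong : ∀ {a a' g g'} → a % p ≡ a' % p → g ≈ₚ g' → map (a ℕ.*_) g ≈ₚ map (a' ℕ.*_) g'
  scale-cong {a} {a'} {g} {g'} a≡a' g≈g' = mk≈ₚ λ i →
    trans (cong (_% p) (coeff-scale a g i))
      (trans (*-cong-mod {a} {a'} {coeff g i} {coeff g' i} a≡a' (≈ₚ-coeff g≈g' i))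
        (cong (_% p) (sym (coeff-scale a' g' i))))

  mulP-zeroˡ : ∀ {f} g → f ≈ₚ [] → mulP f g ≈ₚ []
  mulP-zeroˡ {[]}    g f≈0 = ≈ₚ-refl
  mulP-zeroˡ {a ∷ f} g f≈0 = mk≈ₚ λ i → trans (≈ₚ-coeff a∷f*g≈0∷[] i)
    (cong (_% p) (trans (coeff-addP (map (0 ℕ.*_) g) (0 ∷ []) i) (cong₂ ℕ._+_ (coeff-scale 0 g i) (coeff-[0] i))))
    where
    a∷f*g≈0∷[] : mulP (a ∷ f) g ≈ₚ addP (map (0 ℕ.*_) g) (0 ∷ [])
    a∷f*g≈0∷[] = addP-cong (scale-cong {a} {0} (≈ₚ-coeff f≈0 0) (≈ₚ-refl {g})) (∷-cong refl (mulP-zeroˡ {f} g (tailL-cong f≈0)))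

  mulP-congˡ : ∀ {f f'} g → f ≈ₚ f' → mulP f g ≈ₚ mulP f' g
  mulP-congˡ {[]}    {[]}     g f≈f' = ≈ₚ-refl
  mulP-congˡ {[]}    {_ ∷ _}  g f≈f' = ≈ₚ-sym (mulP-zeroˡ g (≈ₚ-sym f≈f'))
  mulP-congˡ {_ ∷ _} {[]}     g f≈f' = mulP-zeroˡ g f≈f'
  mulP-congˡ {a ∷ f} {a' ∷ f'} g f≈f' =
    addP-cong (scale-cong {a} {a'} (≈ₚ-coeff f≈f' 0) (≈ₚ-refl {g}))
      (∷-cong refl (mulP-congˡ {f} {f'} g (tailL-cong f≈f')))

  mulP-cong : ∀ {f f' g g'} → f ≈ₚ f' → g ≈ₚ g' → mulP f g ≈ₚ mulP f' g'
  mulP-cong {f} {f'} {g} {g'} f≈f' g≈g' =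
    ≈ₚ-trans (mulP-congˡ g f≈f') (≈ₚ-trans (≋⇒≈ₚ (mulP-comm f' g))
      (≈ₚ-trans (mulP-congˡ f' g≈g') (≋⇒≈ₚ (mulP-comm g' f'))))

  𝔽ₚ[T] : CommutativeSemiring _ _
  𝔽ₚ[T] = record
    { Carrier = Poly ; _≈_ = _≈ₚ_ ; _+_ = addP ; _*_ = mulP ; 0# = [] ; 1# = 1 ∷ []
    ; isCommutativeSemiring = isCommutativeSemiringˡ record
      { +-isCommutativeMonoid = record
        { isMonoid = record
          { isSemigroup = record
            { isMagma = record { isEquivalence = ≈ₚ-isEquivalence ; ∙-cong = addP-cong }
            ; assoc = λ f g h → ≋⇒≈ₚ (addP-assoc f g h) }
          ; identity = (λ _ → ≈ₚ-refl) , (λ f → ≋⇒≈ₚ (addP-identityʳ f)) }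
        ; comm = λ f g → ≋⇒≈ₚ (addP-comm f g) }
      ; *-isCommutativeMonoid = record
        { isMonoid = record
          { isSemigroup = record
            { isMagma = record { isEquivalence = ≈ₚ-isEquivalence ; ∙-cong = mulP-cong }
            ; assoc = λ f g h → ≋⇒≈ₚ (mulP-assoc f g h) }
          ; identity = (λ f → ≋⇒≈ₚ (mulP-identityˡ f))
                     , (λ f → ≋⇒≈ₚ (≋-trans (mulP-comm f (1 ∷ [])) (mulP-identityˡ f))) }
        ; comm = λ f g → ≋⇒≈ₚ (mulP-comm f g) }
      ; distribʳ = λ h f g → ≋⇒≈ₚ (mulP-distribʳ f g h)
      ; zeroˡ = λ _ → ≈ₚ-refl } }

module NormalForm (r : ℕ) where

  open import Data.Nat as ℕ using (ℕ; zero; suc; _≤_; _<_; z≤n; s≤s)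
  open import Data.Nat.Properties
    using (≤-refl; ≤-trans; ≤-reflexive; +-identityʳ; <-irrefl; m≤n⇒m<n∨m≡n; m≤n+m; ≰⇒>)
  open import Data.Nat.DivMod using (_%_; m%n%n≡m%n; m%n<n; m<n⇒m%n≡m)
  open import Data.List using (List; []; _∷_; length; _∷ʳ_)
  open import Data.List.Relation.Unary.All using (All; []; _∷_)
  open import Data.Product using (Σ-syntax; _×_; _,_)
  open import Data.Sum using (inj₁; inj₂)
  open import Relation.Nullary using (¬_)
  open import Relation.Binary.PropositionalEquality using (_≡_; _≢_; refl; sym; trans; cong; cong₂; subst)
  open ExactArithmetic
  open ModularArithmetic r

  coeff-cons0 : ∀ x ys i → coeff (cons0 x ys) i ≡ coeff (x ∷ ys) i
  coeff-cons0 zero    []      zero    = refl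
  coeff-cons0 zero    []      (suc i) = refl
  coeff-cons0 zero    (_ ∷ _) i       = refl
  coeff-cons0 (suc x) ys      i       = refl

  cons0-∷ʳ : ∀ x ys y → cons0 x (ys ∷ʳ y) ≡ x ∷ ys ∷ʳ y
  cons0-∷ʳ zero    []      y = refl
  cons0-∷ʳ zero    (_ ∷ _) y = refl
  cons0-∷ʳ (suc x) ys      y = refl

  length-cons0 : ∀ x ys → length (cons0 x ys) ≤ suc (length ys)
  length-cons0 zero    []      = z≤n
  length-cons0 zero    (_ ∷ _) = ≤-refl
  length-cons0 (suc x) ys      = ≤-refl

  coeff-normP : ∀ f i → coeff (normP p f) i ≡ coeff f i % p
  coeff-normP []      i = refl
  coeff-normP (x ∷ f) i = trans (coeff-cons0 (x % p) (normP p f) i) (coeff-∷ i)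
    where
    coeff-∷ : ∀ i → coeff (x % p ∷ normP p f) i ≡ coeff (x ∷ f) i % p
    coeff-∷ zero    = refl
    coeff-∷ (suc i) = coeff-normP f i

  normP-≈ₚ : ∀ f → normP p f ≈ₚ f
  normP-≈ₚ f = mk≈ₚ λ i → trans (cong (_% p) (coeff-normP f i)) (m%n%n≡m%n (coeff f i) p)

  normP-zero : ∀ {f} → f ≈ₚ [] → normP p f ≡ []
  normP-zero {[]}    _   = refl
  normP-zero {x ∷ f} f≈0 rewrite ≈ₚ-coeff f≈0 0 | normP-zero {f} (tailL-cong f≈0) = refl

  ≈ₚ⇒≈[p] : ∀ {f g} → f ≈ₚ g → f ≈[ p ] g
  ≈ₚ⇒≈[p] {[]}    {[]}    f≈g = refl
  ≈ₚ⇒≈[p] {[]}    {_ ∷ _} f≈g = sym (normP-zero (≈ₚ-sym f≈g))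
  ≈ₚ⇒≈[p] {_ ∷ _} {[]}    f≈g = normP-zero f≈g
  ≈ₚ⇒≈[p] {x ∷ f} {y ∷ g} f≈g = cong₂ cons0 (≈ₚ-coeff f≈g 0) (≈ₚ⇒≈[p] {f} {g} (tailL-cong f≈g))

  ≈[p]⇒≈ₚ : ∀ {f g} → f ≈[ p ] g → f ≈ₚ g
  ≈[p]⇒≈ₚ {f} {g} f≈g = ≈ₚ-trans (≈ₚ-sym (normP-≈ₚ f)) (≈ₚ-trans (≈ₚ-reflexive f≈g) (normP-≈ₚ g))

  DegreeBelow : Poly → ℕ → Set
  DegreeBelow f n = ∀ i → n ≤ i → coeff f i % p ≡ 0

  DegreeBelow-tail : ∀ {x f n} → DegreeBelow (x ∷ f) (suc n) → DegreeBelow f n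
  DegreeBelow-tail deg i n≤i = deg (suc i) (s≤s n≤i)

  DegreeBelow-zero : ∀ {f} → DegreeBelow f 0 → f ≈ₚ []
  DegreeBelow-zero deg = mk≈ₚ λ i → deg i z≤n

  coeff-length : ∀ f {i} → length f ≤ i → coeff f i ≡ 0
  coeff-length []      _         = refl
  coeff-length (x ∷ f) (s≤s len) = coeff-length f len

  DegreeBelow-sizeP : ∀ f → DegreeBelow f (sizeP p f)
  DegreeBelow-sizeP f i size≤i = trans (sym (coeff-normP f i)) (coeff-length (normP p f) size≤i)

  sizeP-≤ : ∀ f {n} → DegreeBelow f n → sizeP p f ≤ n
  sizeP-≤ []      {n}     deg = z≤n
  sizeP-≤ (x ∷ f) {zero}  deg = ≤-reflexive (cong length (normP-zero (DegreeBelow-zero {x ∷ f} deg)))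
  sizeP-≤ (x ∷ f) {suc n} deg =
    ≤-trans (length-cons0 (x % p) (normP p f)) (s≤s (sizeP-≤ f (DegreeBelow-tail {x} deg)))

  sizeP-cong : ∀ {f g} → f ≈ₚ g → sizeP p f ≡ sizeP p g
  sizeP-cong f≈g = cong length (≈ₚ⇒≈[p] f≈g)

  DegreeBelow-cong : ∀ {f g n} → f ≈ₚ g → DegreeBelow f n → DegreeBelow g n
  DegreeBelow-cong f≈g deg i n≤i = trans (sym (≈ₚ-coeff f≈g i)) (deg i n≤i)

  DegreeBelow-length : ∀ f → DegreeBelow f (length f)
  DegreeBelow-length f i |f|≤i = cong (_% p) (coeff-length f |f|≤i)

  length-∷ʳ : ∀ xs (y : ℕ) → length (xs ∷ʳ y) ≡ suc (length xs)
  length-∷ʳ []       y = refl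
  length-∷ʳ (x ∷ xs) y = cong suc (length-∷ʳ xs y)

  DegreeBelow-∷ʳ : ∀ xs y → DegreeBelow (xs ∷ʳ y) (suc (length xs))
  DegreeBelow-∷ʳ xs y = subst (DegreeBelow (xs ∷ʳ y)) (length-∷ʳ xs y) (DegreeBelow-length (xs ∷ʳ y))

  coeff≢0⇒<sizeP : ∀ f {i} → coeff f i % p ≢ 0 → i < sizeP p f
  coeff≢0⇒<sizeP f {i} coeffᵢ≢0 = ≰⇒> λ size≤i → coeffᵢ≢0 (DegreeBelow-sizeP f i size≤i)

  sizeP-leading : ∀ f {k} → sizeP p f ≡ suc k → coeff f k % p ≢ 0
  sizeP-leading f {k} size≡1+k coeffₖ≡0 = 1+k≰k (subst (_≤ k) size≡1+k (sizeP-≤ f deg<k))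
    where
    1+k≰k : ¬ (suc k ≤ k)
    1+k≰k = <-irrefl refl
    deg<k : DegreeBelow f k
    deg<k i k≤i with m≤n⇒m<n∨m≡n k≤i
    ... | inj₁ k<i  = DegreeBelow-sizeP f i (subst (_≤ i) (sym size≡1+k) k<i)
    ... | inj₂ refl = coeffₖ≡0

  coeff-mulP-top : ∀ f g a b → DegreeBelow f (suc a) → DegreeBelow g (suc b) →
                   coeff (mulP f g) (a ℕ.+ b) % p ≡ (coeff f a ℕ.* coeff g b) % p
  coeff-mulP-top []      g a       b deg-f deg-g = refl
  coeff-mulP-top (x ∷ f) g zero    b deg-f deg-g =
    trans (cong (_% p) (coeff-mulP-∷ x f g b))
      (trans (+-cong-mod {x ℕ.* coeff g b} {x ℕ.* coeff g b} {coeff (0 ∷ mulP f g) b} {0} refl (fg≈0 b))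
        (cong (_% p) (+-identityʳ (x ℕ.* coeff g b))))
    where
    fg≈0 : ∀ i → coeff (0 ∷ mulP f g) i % p ≡ 0
    fg≈0 zero    = refl
    fg≈0 (suc i) = ≈ₚ-coeff (mulP-zeroˡ {f} g (DegreeBelow-zero (DegreeBelow-tail {x} deg-f))) i
  coeff-mulP-top (x ∷ f) g (suc a) b deg-f deg-g =
    trans (cong (_% p) (coeff-mulP-∷ x f g (suc (a ℕ.+ b))))
      (trans ([a*x+y]%p≡y%p x _ (deg-g (suc (a ℕ.+ b)) (s≤s (m≤n+m b a))))
        (coeff-mulP-top f g a b (DegreeBelow-tail {x} deg-f) deg-g))

  normP-monic : ∀ g n → DegreeBelow g (suc n) → coeff g n % p ≡ 1 →
                Σ[ w ∈ List ℕ ] length w ≡ n × normP p g ≡ w ∷ʳ 1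
  normP-monic (x ∷ g) zero    deg lead
    rewrite lead | normP-zero {g} (DegreeBelow-zero (DegreeBelow-tail {x} deg)) = [] , refl , refl
  normP-monic (x ∷ g) (suc n) deg lead with normP-monic g n (DegreeBelow-tail {x} deg) lead
  ... | w , refl , normP-g = x % p ∷ w , refl , trans (cong (cons0 (x % p)) normP-g) (cons0-∷ʳ (x % p) w 1)

  normP-< : ∀ f → All (_< p) (normP p f)
  normP-< []      = []
  normP-< (x ∷ f) = cons0-< (m%n<n x p) (normP-< f)
    where
    cons0-< : ∀ {x ys} → x < p → All (_< p) ys → All (_< p) (cons0 x ys)
    cons0-< {zero}  {[]}    _   _    = []
    cons0-< {zero}  {_ ∷ _} x<p ys<p = x<p ∷ ys<p
    cons0-< {suc _}         x<p ys<p = x<p ∷ ys<p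

  normP-monic-fixed : ∀ {w} → All (_< p) w → normP p (w ∷ʳ 1) ≡ w ∷ʳ 1
  normP-monic-fixed {[]}    []          = refl
  normP-monic-fixed {x ∷ w} (x<p ∷ w<p) =
    trans (cong (cons0 (x % p)) (normP-monic-fixed w<p))
      (trans (cons0-∷ʳ (x % p) w 1) (cong (λ y → y ∷ w ∷ʳ 1) (m<n⇒m%n≡m x<p)))

module SpecialPolynomials (r : ℕ) where

  open import Data.Nat as ℕ using (ℕ; zero; suc; _∸_)
  import Data.Nat.Properties as ℕ
  open import Data.Nat.DivMod using (_%_; n%n≡0; m%n%n≡m%n)
  open import Data.List using (List; []; _∷_; map; length; reverse; _∷ʳ_)
  open import Data.List.Properties using (unfold-reverse; length-reverse)
  open import Relation.Binary.PropositionalEquality as ≡ using (_≡_)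
  open ExactArithmetic
  open ModularArithmetic r
  open CommutativeSemiring 𝔽ₚ[T] hiding (zero)
  open import Algebra.Properties.Semiring.Mult semiring using (_×_)
  open import Algebra.Properties.Semiring.Exp semiring using (_^_)
  open import Algebra.Solver.Ring.NaturalCoefficients.Default 𝔽ₚ[T]
  open import Relation.Binary.Reasoning.Setoid setoid

  T : Poly
  T = TPow 1

  -1ₚ : Poly
  -1ₚ = constP (p ∸ 1)

  constP-≈0 : ∀ {a} → a % p ≡ 0 → constP a ≈ 0#
  constP-≈0 a≡0 = mk≈ₚ λ { zero → a≡0 ; (suc i) → ≡.refl }

  constP-% : ∀ a → constP (a % p) ≈ constP a
  constP-% a = ∷-cong (m%n%n≡m%n a p) refl

  constP-* : ∀ a b → constP (a ℕ.* b) ≈ constP a * constP b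
  constP-* a b = ≋⇒≈ₚ (mk≋ λ { zero → ≡.sym (ℕ.+-identityʳ _) ; (suc i) → ≡.refl })

  scale≈constP* : ∀ k f → map (k ℕ.*_) f ≈ constP k * f
  scale≈constP* k f = ≋⇒≈ₚ (≋-sym (addP-[0]ʳ (map (k ℕ.*_) f)))

  T*≈0∷ : ∀ f → T * f ≈ 0 ∷ f
  T*≈0∷ f = ≋⇒≈ₚ (≋-trans (mulP-0∷ (1 ∷ []) f) (∷-cong≋ ≡.refl (mulP-identityˡ f)))

  ∷≈constP+T* : ∀ x f → x ∷ f ≈ constP x + T * f
  ∷≈constP+T* x f = sym (trans (+-congˡ {constP x} (T*≈0∷ f)) (≋⇒≈ₚ (∷-cong≋ (ℕ.+-identityʳ x) ≋-refl)))

  TPow≈T^ : ∀ k → TPow k ≈ T ^ k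
  TPow≈T^ zero    = refl
  TPow≈T^ (suc k) = trans (∷-cong ≡.refl (TPow≈T^ k)) (sym (T*≈0∷ (T ^ k)))

  f+-1ₚ*f≈0 : ∀ f → f + -1ₚ * f ≈ 0#
  f+-1ₚ*f≈0 f = begin
    f + -1ₚ * f         ≈⟨ +-congʳ { -1ₚ * f } (sym (*-identityˡ f)) ⟩
    1# * f + -1ₚ * f    ≈⟨ distribʳ f 1# -1ₚ ⟨
    (1# + -1ₚ) * f      ≈⟨ *-congʳ {f} (constP-≈0 (n%n≡0 p)) ⟩
    0# * f              ≈⟨ zeroˡ f ⟩
    0#                  ∎

  -1ₚ*-1ₚ : -1ₚ * -1ₚ ≈ 1#
  -1ₚ*-1ₚ = begin
    -1ₚ * -1ₚ                          ≈⟨ +-identityˡ _ ⟨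
    0# + -1ₚ * -1ₚ                     ≈⟨ +-congʳ { -1ₚ * -1ₚ } (f+-1ₚ*f≈0 1#) ⟨
    (1# + -1ₚ * 1#) + -1ₚ * -1ₚ        ≈⟨ solve 1 (λ n → (con 1 :+ n :* con 1) :+ n :* n := con 1 :+ (n :+ n :* n)) refl -1ₚ ⟩
    1# + (-1ₚ + -1ₚ * -1ₚ)             ≈⟨ +-congˡ {1#} (f+-1ₚ*f≈0 -1ₚ) ⟩
    1# + 0#                            ≈⟨ +-identityʳ 1# ⟩
    1#                                 ∎

  subP≈+-1ₚ* : ∀ f g → subP p f g ≈ f + -1ₚ * g
  subP≈+-1ₚ* f g = +-congˡ {f} (scale≈constP* (p ∸ 1) g)

  ×≈constP* : ∀ n f → n × f ≈ constP n * f
  ×≈constP* zero    f = sym (trans (*-congʳ {f} (constP-≈0 {0} ≡.refl)) (zeroˡ f))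
  ×≈constP* (suc n) f = begin
    f + n × f               ≈⟨ +-cong (sym (*-identityˡ f)) (×≈constP* n f) ⟩
    1# * f + constP n * f   ≈⟨ distribʳ f 1# (constP n) ⟨
    constP (suc n) * f      ∎

  ×1#≈constP : ∀ n → n × 1# ≈ constP n
  ×1#≈constP n = trans (×≈constP* n 1#) (*-identityʳ (constP n))

  char-p : ∀ f → p × f ≈ 0#
  char-p f = trans (×≈constP* p f) (trans (*-congʳ {f} (constP-≈0 (n%n≡0 p))) (zeroˡ f))

  ∷ʳ≈+constP*TPow : ∀ xs y → xs ∷ʳ y ≈ xs + constP y * TPow (length xs)
  ∷ʳ≈+constP*TPow []       y = sym (*-identityʳ (constP y))
  ∷ʳ≈+constP*TPow (x ∷ xs) y = begin
    x ∷ (xs ∷ʳ y)                                            ≈⟨ ∷≈constP+T* x (xs ∷ʳ y) ⟩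
    constP x + T * (xs ∷ʳ y)                                 ≈⟨ +-congˡ {constP x} (*-congˡ {T} (∷ʳ≈+constP*TPow xs y)) ⟩
    constP x + T * (xs + constP y * TPow n)                  ≈⟨ solve 5 (λ x t u y v → x :+ t :* (u :+ y :* v) := (x :+ t :* u) :+ y :* (t :* v))
                                                                       refl (constP x) T xs (constP y) (TPow n) ⟩
    (constP x + T * xs) + constP y * (T * TPow n)            ≈⟨ +-cong (sym (∷≈constP+T* x xs)) (*-congˡ {constP y} (T*≈0∷ (TPow n))) ⟩
    (x ∷ xs) + constP y * TPow (suc n)                       ∎
    where n = length xs

  reverse-∷≈ : ∀ x xs → reverse (x ∷ xs) ≈ constP x * TPow (length xs) + reverse xs
  reverse-∷≈ x xs = begin
    reverse (x ∷ xs)                                   ≡⟨ unfold-reverse x xs ⟩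
    reverse xs ∷ʳ x                                    ≈⟨ ∷ʳ≈+constP*TPow (reverse xs) x ⟩
    reverse xs + constP x * TPow (length (reverse xs)) ≡⟨ ≡.cong (λ n → reverse xs + constP x * TPow n) (length-reverse xs) ⟩
    reverse xs + constP x * TPow (length xs)           ≈⟨ +-comm (reverse xs) _ ⟩
    constP x * TPow (length xs) + reverse xs           ∎

  mPoly≈ : ∀ a → mPoly p a ≈ T ^ p + -1ₚ * T + -1ₚ * constP a
  mPoly≈ a = +-cong (+-cong (TPow≈T^ p) (scale≈constP* (p ∸ 1) T)) (scale≈constP* (p ∸ 1) (constP a))

module Shift (r : ℕ) where

  open import Data.Nat as ℕ using (ℕ; zero; suc; _∸_; s≤s)
  import Data.Nat.Properties as ℕ
  open import Data.Nat.DivMod using (_%_)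
  open import Data.Nat.Primality using (Prime)
  open import Data.List using (List; []; _∷_; map; length)
  open import Data.Product using (_×_; _,_; proj₁; proj₂)
  open import Relation.Binary.PropositionalEquality as ≡ using (_≡_)
  open ExactArithmetic
  open ModularArithmetic r
  open NormalForm r
  open SpecialPolynomials r
  open CommutativeSemiring 𝔽ₚ[T] hiding (zero)
  open Frobenius 𝔽ₚ[T] using (freshmansDream; fermat)
  open import Algebra.Properties.Semiring.Mult semiring renaming (_×_ to _×′_)
  open import Algebra.Properties.Semiring.Exp semiring using (_^_; ^-congˡ)
  open import Algebra.Solver.Ring.NaturalCoefficients.Default 𝔽ₚ[T]
  open import Relation.Binary.Reasoning.Setoid setoid

  T+ : ℕ → Poly
  T+ b = b ∷ 1 ∷ []

  T+≈T+constP : ∀ b → T+ b ≈ T + constP b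
  T+≈T+constP b = ≋⇒≈ₚ (mk≋ λ { zero → ≡.refl ; (suc zero) → ≡.refl ; (suc (suc i)) → ≡.refl })

  shiftP-≈0 : ∀ b {f} → f ≈ 0# → shiftP b f ≈ 0#
  shiftP-≈0 b {[]}    f≈0 = refl
  shiftP-≈0 b {x ∷ f} f≈0 = begin
    constP x + T+ b * shiftP b f  ≈⟨ +-cong (constP-≈0 (≈ₚ-coeff f≈0 0)) (*-congˡ {T+ b} (shiftP-≈0 b {f} (tailL-cong f≈0))) ⟩
    0# + T+ b * 0#                ≈⟨ +-identityˡ (T+ b * 0#) ⟩
    T+ b * 0#                     ≈⟨ zeroʳ (T+ b) ⟩
    0#                            ∎

  shiftP-cong : ∀ b {f g} → f ≈ g → shiftP b f ≈ shiftP b g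
  shiftP-cong b {[]}    {[]}    f≈g = refl
  shiftP-cong b {[]}    {_ ∷ _} f≈g = sym (shiftP-≈0 b (sym f≈g))
  shiftP-cong b {_ ∷ _} {[]}    f≈g = shiftP-≈0 b f≈g
  shiftP-cong b {x ∷ f} {y ∷ g} f≈g =
    +-cong (∷-cong (≈ₚ-coeff f≈g 0) refl) (*-congˡ {T+ b} (shiftP-cong b {f} {g} (tailL-cong f≈g)))

  shiftP-addP : ∀ b f g → shiftP b (f + g) ≈ shiftP b f + shiftP b g
  shiftP-addP b []      g       = refl
  shiftP-addP b (x ∷ f) []      = sym (+-identityʳ _)
  shiftP-addP b (x ∷ f) (y ∷ g) = begin
    constP (x ℕ.+ y) + T+ b * shiftP b (f + g)
      ≈⟨ +-congˡ {constP (x ℕ.+ y)} (*-congˡ {T+ b} (shiftP-addP b f g)) ⟩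
    (constP x + constP y) + T+ b * (shiftP b f + shiftP b g)
      ≈⟨ solve 5 (λ x y t u v → (x :+ y) :+ t :* (u :+ v) := (x :+ t :* u) :+ (y :+ t :* v))
               refl (constP x) (constP y) (T+ b) (shiftP b f) (shiftP b g) ⟩
    (constP x + T+ b * shiftP b f) + (constP y + T+ b * shiftP b g) ∎

  shiftP-scale : ∀ b k f → shiftP b (map (k ℕ.*_) f) ≈ constP k * shiftP b f
  shiftP-scale b k []      = sym (zeroʳ (constP k))
  shiftP-scale b k (x ∷ f) = begin
    constP (k ℕ.* x) + T+ b * shiftP b (map (k ℕ.*_) f)
      ≈⟨ +-cong (constP-* k x) (*-congˡ {T+ b} (shiftP-scale b k f)) ⟩
    constP k * constP x + T+ b * (constP k * shiftP b f)
      ≈⟨ solve 4 (λ k x t u → k :* x :+ t :* (k :* u) := k :* (x :+ t :* u))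
               refl (constP k) (constP x) (T+ b) (shiftP b f) ⟩
    constP k * (constP x + T+ b * shiftP b f) ∎

  shiftP-0∷ : ∀ b f → shiftP b (0 ∷ f) ≈ T+ b * shiftP b f
  shiftP-0∷ b f = trans (+-congʳ {T+ b * shiftP b f} (constP-≈0 {0} ≡.refl)) (+-identityˡ _)

  shiftP-constP : ∀ b c → shiftP b (constP c) ≈ constP c
  shiftP-constP b c = trans (+-congˡ {constP c} (zeroʳ (T+ b))) (+-identityʳ (constP c))

  shiftP-mulP : ∀ b f g → shiftP b (f * g) ≈ shiftP b f * shiftP b g
  shiftP-mulP b []      g = sym (zeroˡ (shiftP b g))
  shiftP-mulP b (a ∷ f) g = begin
    shiftP b (map (a ℕ.*_) g + (0 ∷ f * g))
      ≈⟨ shiftP-addP b (map (a ℕ.*_) g) (0 ∷ f * g) ⟩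
    shiftP b (map (a ℕ.*_) g) + shiftP b (0 ∷ f * g)
      ≈⟨ +-cong (shiftP-scale b a g) (trans (shiftP-0∷ b (f * g)) (*-congˡ {T+ b} (shiftP-mulP b f g))) ⟩
    constP a * shiftP b g + T+ b * (shiftP b f * shiftP b g)
      ≈⟨ solve 4 (λ a g t f → a :* g :+ t :* (f :* g) := (a :+ t :* f) :* g)
               refl (constP a) (shiftP b g) (T+ b) (shiftP b f) ⟩
    (constP a + T+ b * shiftP b f) * shiftP b g ∎

  shiftP-TPow : ∀ b k → shiftP b (TPow k) ≈ T+ b ^ k
  shiftP-TPow b zero    = shiftP-constP b 1
  shiftP-TPow b (suc k) = trans (shiftP-0∷ b (TPow k)) (*-congˡ {T+ b} (shiftP-TPow b k))

  shiftP-T : ∀ b → shiftP b T ≈ T+ b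
  shiftP-T b = trans (shiftP-TPow b 1) (*-identityʳ (T+ b))

  T+b^p≈T^p+b : Prime p → ∀ b → T+ b ^ p ≈ T ^ p + constP b
  T+b^p≈T^p+b p-prime b = begin
    T+ b ^ p                 ≈⟨ ^-congˡ p (T+≈T+constP b) ⟩
    (T + constP b) ^ p       ≈⟨ freshmansDream p-prime char-p T (constP b) ⟩
    T ^ p + constP b ^ p     ≈⟨ +-congˡ {T ^ p} (^-congˡ p (×1#≈constP b)) ⟨
    T ^ p + (b ×′ 1#) ^ p    ≈⟨ +-congˡ {T ^ p} (fermat p-prime char-p b) ⟩
    T ^ p + b ×′ 1#          ≈⟨ +-congˡ {T ^ p} (×1#≈constP b) ⟩
    T ^ p + constP b         ∎

  shiftP-mPoly : Prime p → ∀ b a → shiftP b (mPoly p a) ≈ mPoly p a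
  shiftP-mPoly p-prime b a = begin
    shiftP b ((TPow p + -T) + -a)
      ≈⟨ trans (shiftP-addP b (TPow p + -T) -a) (+-congʳ {shiftP b -a} (shiftP-addP b (TPow p) -T)) ⟩
    shiftP b (TPow p) + shiftP b -T + shiftP b -a
      ≈⟨ +-cong (+-cong (shiftP-TPow b p) (shiftP-scale b (p ∸ 1) T)) (shiftP-scale b (p ∸ 1) (constP a)) ⟩
    T+ b ^ p + -1ₚ * shiftP b T + -1ₚ * shiftP b (constP a)
      ≈⟨ +-cong (+-cong (T+b^p≈T^p+b p-prime b) (*-congˡ { -1ₚ } (trans (shiftP-T b) (T+≈T+constP b))))
                (*-congˡ { -1ₚ } (shiftP-constP b a)) ⟩
    (T ^ p + constP b) + -1ₚ * (T + constP b) + -1ₚ * constP a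
      ≈⟨ solve 5 (λ tᵖ t b a n → (tᵖ :+ b) :+ n :* (t :+ b) :+ n :* a := (tᵖ :+ n :* t :+ n :* a) :+ (b :+ n :* b))
               refl (T ^ p) T (constP b) (constP a) -1ₚ ⟩
    (T ^ p + -1ₚ * T + -1ₚ * constP a) + (constP b + -1ₚ * constP b)
      ≈⟨ +-congˡ {T ^ p + -1ₚ * T + -1ₚ * constP a} (f+-1ₚ*f≈0 (constP b)) ⟩
    (T ^ p + -1ₚ * T + -1ₚ * constP a) + 0#
      ≈⟨ +-identityʳ _ ⟩
    T ^ p + -1ₚ * T + -1ₚ * constP a
      ≈⟨ mPoly≈ a ⟨
    mPoly p a ∎
    where
    -T = map ((p ∸ 1) ℕ.*_) T
    -a = map ((p ∸ 1) ℕ.*_) (constP a)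

  shiftP-inverse : ∀ b c → (b ℕ.+ c) % p ≡ 0 → ∀ f → shiftP c (shiftP b f) ≈ f
  shiftP-inverse b c b+c≡0 []      = refl
  shiftP-inverse b c b+c≡0 (x ∷ f) = begin
    shiftP c (constP x + T+ b * shiftP b f)
      ≈⟨ shiftP-addP c (constP x) (T+ b * shiftP b f) ⟩
    shiftP c (constP x) + shiftP c (T+ b * shiftP b f)
      ≈⟨ +-cong (shiftP-constP c x) (shiftP-mulP c (T+ b) (shiftP b f)) ⟩
    constP x + shiftP c (T+ b) * shiftP c (shiftP b f)
      ≈⟨ +-congˡ {constP x} (*-cong shiftP-T+b (shiftP-inverse b c b+c≡0 f)) ⟩
    constP x + T * f
      ≈⟨ ∷≈constP+T* x f ⟨
    x ∷ f ∎
    where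
    shiftP-T+b : shiftP c (T+ b) ≈ T
    shiftP-T+b = begin
      constP b + T+ c * shiftP c (1 ∷ [])  ≈⟨ +-congˡ {constP b} (trans (*-congˡ {T+ c} (shiftP-constP c 1)) (*-identityʳ (T+ c))) ⟩
      constP b + T+ c                      ≈⟨ +-congˡ {constP b} (T+≈T+constP c) ⟩
      constP b + (T + constP c)            ≈⟨ solve 3 (λ b t c → b :+ (t :+ c) := t :+ (b :+ c)) refl (constP b) T (constP c) ⟩
      T + constP (b ℕ.+ c)                 ≈⟨ +-congˡ {T} (constP-≈0 b+c≡0) ⟩
      T + 0#                               ≈⟨ +-identityʳ T ⟩
      T                                    ∎

  coeff-shiftP-∷ : ∀ b c h j →
    coeff (shiftP b (c ∷ h)) (suc j) ≡ b ℕ.* coeff (shiftP b h) (suc j) ℕ.+ coeff (shiftP b h) j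
  coeff-shiftP-∷ b c h j =
    ≡.trans (coeff-addP (constP c) (T+ b * shiftP b h) (suc j))
      (≡.trans (coeff-mulP-∷ b (1 ∷ []) (shiftP b h) (suc j))
        (≡.cong (b ℕ.* coeff (shiftP b h) (suc j) ℕ.+_) (≋-coeff (mulP-identityˡ (shiftP b h)) j)))

  shiftP-degree : ∀ b h n → DegreeBelow h (suc n) →
                  DegreeBelow (shiftP b h) (suc n) × coeff (shiftP b h) n % p ≡ coeff h n % p
  shiftP-degree b []      n       _   = (λ _ _ → ≡.refl) , ≡.refl
  shiftP-degree b (c ∷ h) zero    deg =
    (λ { (suc i) _ → ≈ₚ-coeff shiftP≈c (suc i) }) , ≈ₚ-coeff shiftP≈c 0
    where
    shiftP≈c : shiftP b (c ∷ h) ≈ constP c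
    shiftP≈c = trans (+-congˡ {constP c} (trans (*-congˡ {T+ b} (shiftP-≈0 b {h} (DegreeBelow-zero (DegreeBelow-tail {c} deg))))
                                                 (zeroʳ (T+ b))))
                     (+-identityʳ (constP c))
  shiftP-degree b (c ∷ h) (suc n) deg = bound , lead
    where
    ih = shiftP-degree b h n (DegreeBelow-tail {c} deg)
    bound : DegreeBelow (shiftP b (c ∷ h)) (suc (suc n))
    bound (suc j) (s≤s n<j) = ≡.trans (≡.cong (_% p) (coeff-shiftP-∷ b c h j))
      (≡.trans ([a*x+y]%p≡y%p b _ (proj₁ ih (suc j) (ℕ.m≤n⇒m≤1+n n<j))) (proj₁ ih j n<j))
    lead : coeff (shiftP b (c ∷ h)) (suc n) % p ≡ coeff h n % p
    lead = ≡.trans (≡.cong (_% p) (coeff-shiftP-∷ b c h n))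
      (≡.trans ([a*x+y]%p≡y%p b _ (proj₁ ih (suc n) ℕ.≤-refl)) (proj₂ ih))

  sizeP-shiftP : ∀ b g → sizeP p (shiftP b g) ≡ sizeP p g
  sizeP-shiftP b g with normP p g in normP-g
  ... | []     = ≡.cong length (≈ₚ⇒≈[p] (shiftP-≈0 b {g} (≈[p]⇒≈ₚ {g} {[]} normP-g)))
  ... | x ∷ xs = ℕ.≤-antisym (sizeP-≤ (shiftP b g) (proj₁ shifted))
                             (coeff≢0⇒<sizeP (shiftP b g) λ lead≡0 → sizeP-leading g size-g (≡.trans (≡.sym (proj₂ shifted)) lead≡0))
    where
    size-g : sizeP p g ≡ suc (length xs)
    size-g = ≡.cong length normP-g
    shifted = shiftP-degree b g (length xs) (≡.subst (DegreeBelow g) size-g (DegreeBelow-sizeP g))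

module MonicDivision (r : ℕ) (m : Poly) {mlow : List ℕ}
                     (m-monic : normP (suc (suc r)) m ≡ mlow ∷ʳ 1) where

  open import Data.Nat as ℕ using (ℕ; zero; suc; _∸_)
  import Data.Nat.Properties as ℕ
  open import Data.Nat.DivMod using (_%_)
  import Data.Bool as Bool
  open import Data.List using (List; []; _∷_; map; length; reverse; _∷ʳ_; _++_; zipWith; replicate; foldl; null)
  open import Data.List.Properties
    using ( length-map; length-zipWith; length-reverse; length-replicate
          ; reverse-involutive; reverse-++; unfold-reverse; foldl-∷ʳ)
  open import Data.Product using (Σ-syntax; _×_; _,_; proj₁; proj₂)
  open import Data.Empty using (⊥-elim)
  open import Relation.Binary.PropositionalEquality as ≡ using (_≡_)
  open ExactArithmetic
  open ModularArithmetic r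
  open NormalForm r
  open SpecialPolynomials r
  open CommutativeSemiring 𝔽ₚ[T] hiding (zero)
  open import Algebra.Solver.Ring.NaturalCoefficients.Default 𝔽ₚ[T]
  open import Relation.Binary.Reasoning.Setoid setoid

  d : ℕ
  d = length mlow

  m≈mlow+TPow : m ≈ mlow + TPow d
  m≈mlow+TPow = begin
    m                                ≈⟨ normP-≈ₚ m ⟨
    normP p m                        ≡⟨ m-monic ⟩
    mlow ∷ʳ 1                        ≈⟨ ∷ʳ≈+constP*TPow mlow 1 ⟩
    mlow + constP 1 * TPow d         ≈⟨ +-congˡ {mlow} (*-identityˡ (TPow d)) ⟩
    mlow + TPow d                    ∎

  initL-∷ʳ : ∀ xs (y : ℕ) → initL (xs ∷ʳ y) ≡ xs
  initL-∷ʳ []           y = ≡.refl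
  initL-∷ʳ (x ∷ [])     y = ≡.refl
  initL-∷ʳ (x ∷ x' ∷ xs) y = ≡.cong (x ∷_) (initL-∷ʳ (x' ∷ xs) y)

  -- As in remMonic, mhigh and the running remainder list coefficients from high to low degree.
  mhigh : List ℕ
  mhigh = reverse (initL (normP p m))

  reverse-mhigh : reverse mhigh ≡ mlow
  reverse-mhigh = ≡.trans (reverse-involutive _) (≡.trans (≡.cong initL m-monic) (initL-∷ʳ mlow 1))

  length-mhigh : length mhigh ≡ d
  length-mhigh = ≡.trans (≡.sym (length-reverse mhigh)) (≡.cong length reverse-mhigh)

  divStep : List ℕ → ℕ → List ℕ
  divStep ρ c = let s = ρ ++ (c ∷ []) ; top = headOr s in
                map (modP p) (zipWith (λ x y → x ℕ.+ (p ∸ 1) ℕ.* top ℕ.* y) (tailL s) mhigh)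

  divFold : Poly → List ℕ
  divFold g = foldl divStep (replicate (length mhigh) 0) (reverse g)

  ∷ʳ≡headOr∷tailL : ∀ xs (y : ℕ) → xs ∷ʳ y ≡ headOr (xs ∷ʳ y) ∷ tailL (xs ∷ʳ y)
  ∷ʳ≡headOr∷tailL []      y = ≡.refl
  ∷ʳ≡headOr∷tailL (_ ∷ _) y = ≡.refl

  length-tailL-∷ʳ : ∀ xs (y : ℕ) → length (tailL (xs ∷ʳ y)) ≡ length xs
  length-tailL-∷ʳ []       y = ≡.refl
  length-tailL-∷ʳ (x ∷ xs) y = length-∷ʳ xs y

  module _ (c : ℕ) where

    addScaled : ℕ → ℕ → ℕ
    addScaled a b = a ℕ.+ c ℕ.* b

    length-mod-zipWith : ∀ σ τ → length σ ≡ length τ → length (map (modP p) (zipWith addScaled σ τ)) ≡ length σ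
    length-mod-zipWith σ τ eq = ≡.trans (length-map (modP p) (zipWith addScaled σ τ))
      (≡.trans (length-zipWith addScaled σ τ) (≡.trans (≡.cong (length σ ℕ.⊓_) (≡.sym eq)) (ℕ.⊓-idem (length σ))))

    reverse-mod-zipWith : ∀ σ τ → length σ ≡ length τ →
      reverse (map (modP p) (zipWith addScaled σ τ)) ≈ reverse σ + constP c * reverse τ
    reverse-mod-zipWith []      []      _  = sym (zeroʳ (constP c))
    reverse-mod-zipWith (a ∷ σ) (b ∷ τ) eq = begin
      reverse (addScaled a b % p ∷ rest)
        ≈⟨ reverse-∷≈ (addScaled a b % p) rest ⟩
      constP (addScaled a b % p) * TPow (length rest) + reverse rest
        ≈⟨ +-cong (*-cong (constP-% (addScaled a b)) (≈ₚ-reflexive (≡.cong TPow |rest|≡|τ|)))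
                  (reverse-mod-zipWith σ τ |σ|≡|τ|) ⟩
      (constP a + constP (c ℕ.* b)) * TPow (length τ) + (reverse σ + constP c * reverse τ)
        ≈⟨ +-congʳ {reverse σ + constP c * reverse τ} (*-congʳ {TPow (length τ)} (+-congˡ {constP a} (constP-* c b))) ⟩
      (constP a + constP c * constP b) * TPow (length τ) + (reverse σ + constP c * reverse τ)
        ≈⟨ solve 6 (λ a c b x s u → (a :+ c :* b) :* x :+ (s :+ c :* u) := (a :* x :+ s) :+ c :* (b :* x :+ u))
                 refl (constP a) (constP c) (constP b) (TPow (length τ)) (reverse σ) (reverse τ) ⟩
      (constP a * TPow (length τ) + reverse σ) + constP c * (constP b * TPow (length τ) + reverse τ)
        ≈⟨ +-cong (+-congʳ {reverse σ} (*-congˡ {constP a} (≈ₚ-reflexive (≡.cong TPow (≡.sym |σ|≡|τ|)))))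
                  (*-congˡ {constP c} (sym (reverse-∷≈ b τ))) ⟩
      (constP a * TPow (length σ) + reverse σ) + constP c * reverse (b ∷ τ)
        ≈⟨ +-congʳ {constP c * reverse (b ∷ τ)} (sym (reverse-∷≈ a σ)) ⟩
      reverse (a ∷ σ) + constP c * reverse (b ∷ τ) ∎
      where
      rest = map (modP p) (zipWith addScaled σ τ)
      |σ|≡|τ| = ℕ.suc-injective eq
      |rest|≡|τ| : length rest ≡ length τ
      |rest|≡|τ| = ≡.trans (length-mod-zipWith σ τ |σ|≡|τ|) |σ|≡|τ|

  -- One step of long division: the top coefficient t of ρ ∷ʳ x is cleared by subtracting t·m.
  divStep-correct : ∀ ρ x → length ρ ≡ d →
    length (divStep ρ x) ≡ d × reverse (ρ ∷ʳ x) ≈ m * constP (headOr (ρ ∷ʳ x)) + reverse (divStep ρ x)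
  divStep-correct ρ x |ρ|≡d = ≡.trans (length-mod-zipWith c σ mhigh |σ|≡|mhigh|) |σ|≡d , value
    where
    t = headOr (ρ ∷ʳ x)
    σ = tailL (ρ ∷ʳ x)
    c = (p ∸ 1) ℕ.* t
    |σ|≡d : length σ ≡ d
    |σ|≡d = ≡.trans (length-tailL-∷ʳ ρ x) |ρ|≡d
    |σ|≡|mhigh| : length σ ≡ length mhigh
    |σ|≡|mhigh| = ≡.trans |σ|≡d (≡.sym length-mhigh)
    value : reverse (ρ ∷ʳ x) ≈ m * constP t + reverse (divStep ρ x)
    value = begin
      reverse (ρ ∷ʳ x)
        ≡⟨ ≡.cong reverse (∷ʳ≡headOr∷tailL ρ x) ⟩
      reverse (t ∷ σ)
        ≈⟨ reverse-∷≈ t σ ⟩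
      constP t * TPow (length σ) + reverse σ
        ≡⟨ ≡.cong (λ n → constP t * TPow n + reverse σ) |σ|≡d ⟩
      constP t * TPow d + reverse σ
        ≈⟨ +-identityʳ _ ⟨
      (constP t * TPow d + reverse σ) + 0#
        ≈⟨ +-congˡ {constP t * TPow d + reverse σ} (f+-1ₚ*f≈0 (constP t * mlow)) ⟨
      (constP t * TPow d + reverse σ) + (constP t * mlow + -1ₚ * (constP t * mlow))
        ≈⟨ solve 5 (λ t x s l n → (t :* x :+ s) :+ (t :* l :+ n :* (t :* l)) := (l :+ x) :* t :+ (s :+ (n :* t) :* l))
                 refl (constP t) (TPow d) (reverse σ) mlow -1ₚ ⟩
      (mlow + TPow d) * constP t + (reverse σ + (-1ₚ * constP t) * mlow)
        ≈⟨ +-cong (*-congʳ {constP t} m≈mlow+TPow)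
                  (+-congˡ {reverse σ} (*-cong (constP-* (p ∸ 1) t) (≈ₚ-reflexive reverse-mhigh))) ⟨
      m * constP t + (reverse σ + constP c * reverse mhigh)
        ≈⟨ +-congˡ {m * constP t} (reverse-mod-zipWith c σ mhigh |σ|≡|mhigh|) ⟨
      m * constP t + reverse (divStep ρ x) ∎

  reverse-replicate-0 : ∀ n → reverse (replicate n 0) ≈ 0#
  reverse-replicate-0 zero    = refl
  reverse-replicate-0 (suc n) = begin
    reverse (0 ∷ replicate n 0)                  ≈⟨ reverse-∷≈ 0 (replicate n 0) ⟩
    constP 0 * X + reverse (replicate n 0)       ≈⟨ +-cong (*-congʳ {X} (constP-≈0 {0} ≡.refl)) (reverse-replicate-0 n) ⟩
    0# * X + 0#                                  ≈⟨ +-identityʳ _ ⟩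
    0# * X                                       ≈⟨ zeroˡ X ⟩
    0#                                           ∎
    where X = TPow (length (replicate n 0))

  divFold-∷ : ∀ x g → divFold (x ∷ g) ≡ divStep (divFold g) x
  divFold-∷ x g = ≡.trans (≡.cong (foldl divStep _) (unfold-reverse x g)) (foldl-∷ʳ divStep _ x (reverse g))

  divFold-correct : ∀ g → length (divFold g) ≡ d × Σ[ q ∈ Poly ] g ≈ m * q + reverse (divFold g)
  divFold-correct [] = ≡.trans (length-replicate (length mhigh)) length-mhigh , [] ,
    sym (trans (+-congʳ {reverse (replicate (length mhigh) 0)} (zeroʳ m)) (reverse-replicate-0 (length mhigh)))
  divFold-correct (x ∷ g) =
    ≡.trans (≡.cong length (divFold-∷ x g)) (proj₁ step) , T * q + constP t , (begin
    x ∷ g                                             ≈⟨ ∷≈constP+T* x g ⟩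
    constP x + T * g                                  ≈⟨ +-congˡ {constP x} (*-congˡ {T} (proj₂ (proj₂ ih))) ⟩
    constP x + T * (m * q + R)                        ≈⟨ regroup (constP x) T m q R ⟩
    m * (T * q) + (constP x + T * R)                  ≈⟨ +-congˡ {m * (T * q)} (sym (∷≈constP+T* x R)) ⟩
    m * (T * q) + (x ∷ R)                             ≡⟨ ≡.cong (λ h → m * (T * q) + h) (≡.sym (reverse-++ (divFold g) (x ∷ []))) ⟩
    m * (T * q) + reverse (divFold g ∷ʳ x)            ≈⟨ +-congˡ {m * (T * q)} (proj₂ step) ⟩
    m * (T * q) + (m * constP t + reverse (divStep (divFold g) x))
                                                      ≈⟨ +-assoc (m * (T * q)) (m * constP t) (reverse (divStep (divFold g) x)) ⟨
    (m * (T * q) + m * constP t) + reverse (divStep (divFold g) x)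
                                                      ≈⟨ +-congʳ {reverse (divStep (divFold g) x)} (distribˡ m (T * q) (constP t)) ⟨
    m * (T * q + constP t) + reverse (divStep (divFold g) x)
                                                      ≡⟨ ≡.cong (λ h → m * (T * q + constP t) + reverse h) (≡.sym (divFold-∷ x g)) ⟩
    m * (T * q + constP t) + reverse (divFold (x ∷ g)) ∎)
    where
    ih = divFold-correct g
    q = proj₁ (proj₂ ih)
    step = divStep-correct (divFold g) x (proj₁ ih)
    R = reverse (divFold g)
    t = headOr (divFold g ∷ʳ x)
    regroup : ∀ x t m q ρ → x + t * (m * q + ρ) ≈ m * (t * q) + (x + t * ρ)
    regroup = solve 5 (λ x t m q ρ → x :+ t :* (m :* q :+ ρ) := m :* (t :* q) :+ (x :+ t :* ρ)) refl

  remainder-degree : ∀ g → DegreeBelow (reverse (divFold g)) d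
  remainder-degree g i d≤i = ≡.cong (_% p) (coeff-length (reverse (divFold g))
    (ℕ.≤-trans (ℕ.≤-reflexive (≡.trans (length-reverse (divFold g)) (proj₁ (divFold-correct g)))) d≤i))

  sizeP-m : sizeP p m ≡ suc d
  sizeP-m = ≡.trans (≡.cong length m-monic) (length-∷ʳ mlow 1)

  leading-m : coeff m d % p ≡ 1
  leading-m = ≡.trans (≡.sym (coeff-normP m d)) (≡.trans (≡.cong (λ h → coeff h d) m-monic) (coeff-∷ʳ mlow 1))

  -- If q ≉ 0, the coefficient of m·q in degree d + deg q is the leading coefficient of q ≢ 0.
  monic-multiple-degree : ∀ q → DegreeBelow (m * q) d → q ≈ 0#
  monic-multiple-degree q deg with normP p q in normP-q
  ... | []     = ≈[p]⇒≈ₚ normP-q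
  ... | x ∷ xs = ⊥-elim (sizeP-leading q (≡.cong length normP-q) qₖ≡0)
    where
    k = length xs
    deg-q : DegreeBelow q (suc k)
    deg-q = ≡.subst (DegreeBelow q) (≡.cong length normP-q) (DegreeBelow-sizeP q)
    mq-top : coeff (m * q) (d ℕ.+ k) % p ≡ coeff q k % p
    mq-top = ≡.trans (coeff-mulP-top m q d k (≡.subst (DegreeBelow m) sizeP-m (DegreeBelow-sizeP m)) deg-q)
      (≡.trans (*-cong-mod {coeff m d} {1} {coeff q k} {coeff q k} leading-m ≡.refl)
        (≡.cong (_% p) (ℕ.*-identityˡ (coeff q k))))
    qₖ≡0 : coeff q k % p ≡ 0
    qₖ≡0 = ≡.trans (≡.sym mq-top) (deg (d ℕ.+ k) (ℕ.m≤m+n d k))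

  dvdMonicB-sound : ∀ g → Bool.T (dvdMonicB p m g) → Divides p m g
  dvdMonicB-sound g rem-null = q , ≈ₚ⇒≈[p] (begin
    g            ≈⟨ normP-≈ₚ g ⟨
    normP p g    ≈⟨ proj₂ (proj₂ fold) ⟩
    m * q + R    ≈⟨ +-congˡ {m * q} (≈[p]⇒≈ₚ (null⇒≡[] rem-null)) ⟩
    m * q + 0#   ≈⟨ +-identityʳ (m * q) ⟩
    m * q        ∎)
    where
    fold = divFold-correct (normP p g)
    q = proj₁ (proj₂ fold)
    R = reverse (divFold (normP p g))
    null⇒≡[] : ∀ {xs : List ℕ} → Bool.T (null xs) → xs ≡ []
    null⇒≡[] {[]}    _  = ≡.refl
    null⇒≡[] {_ ∷ _} ()

  dvdMonicB-complete : ∀ g → Divides p m g → Bool.T (dvdMonicB p m g)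
  dvdMonicB-complete g (q₀ , g≈mq₀) = ≡.subst (λ xs → Bool.T (null xs)) (≡.sym (≈ₚ⇒≈[p] R≈0)) _
    where
    fold = divFold-correct (normP p g)
    q = proj₁ (proj₂ fold)
    R = reverse (divFold (normP p g))
    R≈m[q₀-q] : R ≈ m * (q₀ + -1ₚ * q)
    R≈m[q₀-q] = begin
      R                                 ≈⟨ +-identityˡ R ⟨
      0# + R                            ≈⟨ +-congʳ {R} (f+-1ₚ*f≈0 (m * q)) ⟨
      (m * q + -1ₚ * (m * q)) + R       ≈⟨ solve 3 (λ mq n ρ → (mq :+ n :* mq) :+ ρ := n :* mq :+ (mq :+ ρ)) refl (m * q) -1ₚ R ⟩
      -1ₚ * (m * q) + (m * q + R)       ≈⟨ +-congˡ { -1ₚ * (m * q) } (proj₂ (proj₂ fold)) ⟨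
      -1ₚ * (m * q) + normP p g         ≈⟨ +-congˡ { -1ₚ * (m * q) } (trans (normP-≈ₚ g) (≈[p]⇒≈ₚ g≈mq₀)) ⟩
      -1ₚ * (m * q) + m * q₀            ≈⟨ solve 4 (λ n m q q₀ → n :* (m :* q) :+ m :* q₀ := m :* (q₀ :+ n :* q)) refl -1ₚ m q q₀ ⟩
      m * (q₀ + -1ₚ * q)                ∎
    R≈0 : R ≈ 0#
    R≈0 = begin
      R                     ≈⟨ R≈m[q₀-q] ⟩
      m * (q₀ + -1ₚ * q)    ≈⟨ *-congˡ {m} (monic-multiple-degree (q₀ + -1ₚ * q)
                                 (DegreeBelow-cong R≈m[q₀-q] (remainder-degree (normP p g)))) ⟩
      m * 0#                ≈⟨ zeroʳ m ⟩
      0#                    ∎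

module Modulus (r : ℕ) (a : ℕ) where

  open import Data.Nat as ℕ using (ℕ; zero; suc; _<_; s≤s)
  open import Data.Nat.Properties using (+-identityʳ)
  open import Data.List using (List)
  open import Data.Product using (Σ-syntax; _,_)
  open import Relation.Binary.PropositionalEquality using (_≡_; refl; trans; cong)
  open ExactArithmetic
  open ModularArithmetic r
  open NormalForm r

  coeff-TPow-self : ∀ n → coeff (TPow n) n ≡ 1
  coeff-TPow-self zero    = refl
  coeff-TPow-self (suc n) = coeff-TPow-self n

  coeff-TPow-> : ∀ n {i} → n < i → coeff (TPow n) i ≡ 0
  coeff-TPow-> zero    {suc i} _         = refl
  coeff-TPow-> (suc n) {suc i} (s≤s n<i) = coeff-TPow-> n n<i

  -- -T and -a only have coefficients in degrees 0 and 1
  coeff-mPoly : ∀ i → coeff (mPoly p a) (suc (suc i)) ≡ coeff (TPow p) (suc (suc i))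
  coeff-mPoly i = trans (coeff-addP (subP p (TPow p) (TPow 1)) (negP p (constP a)) (suc (suc i)))
    (trans (+-identityʳ _) (trans (coeff-addP (TPow p) (negP p (TPow 1)) (suc (suc i))) (+-identityʳ _)))

  mPoly-degree : DegreeBelow (mPoly p a) (suc p)
  mPoly-degree (suc zero)    (s≤s ())
  mPoly-degree (suc (suc i)) p<i = cong (ℕ._% p) (trans (coeff-mPoly i) (coeff-TPow-> p p<i))

  mPoly-leading : coeff (mPoly p a) p ℕ.% p ≡ 1
  mPoly-leading = cong (ℕ._% p) (trans (coeff-mPoly r) (coeff-TPow-self p))

  mPoly-monic : Σ[ mlow ∈ List ℕ ] normP p (mPoly p a) ≡ mlow ∷ʳ 1
  mPoly-monic with normP-monic (mPoly p a) p mPoly-degree mPoly-leading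
  ... | mlow , _ , normP≡ = mlow , normP≡

module Enumeration (r : ℕ) where

  open import Data.Nat using (ℕ; zero; suc; _<_)
  open import Data.List using (List; []; _∷_; map; _++_; length; upTo; concatMap; cartesianProductWith)
  open import Data.List.Properties using (∷-injective; ∷ʳ-injectiveˡ)
  open import Data.List.Membership.Propositional using (_∈_)
  open import Data.List.Membership.Propositional.Properties
    using (∈-cartesianProductWith⁺; ∈-cartesianProductWith⁻; ∈-upTo⁺; ∈-upTo⁻; ∈-map⁺; ∈-map⁻)
  open import Data.List.Relation.Unary.Any using (here)
  open import Data.List.Relation.Unary.All using (All; []; _∷_)
  open import Data.List.Relation.Unary.AllPairs using ([]; _∷_)
  open import Data.List.Relation.Unary.Unique.Propositional using (Unique)
  import Data.List.Relation.Unary.Unique.Propositional.Properties as Unique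
  open import Data.Product using (Σ-syntax; _×_; _,_)
  open import Relation.Binary.PropositionalEquality using (_≡_; refl; sym; cong; subst)
  open ModularArithmetic r using (p)

  concatMap≡cartesianProductWith : ∀ {A B C : Set} (f : A → B → C) xs ys →
    concatMap (λ x → map (f x) ys) xs ≡ cartesianProductWith f xs ys
  concatMap≡cartesianProductWith f []       ys = refl
  concatMap≡cartesianProductWith f (x ∷ xs) ys = cong (map (f x) ys ++_) (concatMap≡cartesianProductWith f xs ys)

  vecsP-suc : ∀ n → vecsP p (suc n) ≡ cartesianProductWith _∷_ (upTo p) (vecsP p n)
  vecsP-suc n = concatMap≡cartesianProductWith _∷_ (upTo p) (vecsP p n)

  ∈-vecsP⁻ : ∀ n {v} → v ∈ vecsP p n → length v ≡ n × All (_< p) v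
  ∈-vecsP⁻ zero    (here refl) = refl , []
  ∈-vecsP⁻ (suc n) v∈ with ∈-cartesianProductWith⁻ _∷_ (upTo p) (vecsP p n) (subst (_ ∈_) (vecsP-suc n) v∈)
  ... | x , w , x∈ , w∈ , refl with ∈-vecsP⁻ n w∈
  ...   | |w|≡n , w<p = cong suc |w|≡n , ∈-upTo⁻ x∈ ∷ w<p

  ∈-vecsP⁺ : ∀ {v} → All (_< p) v → v ∈ vecsP p (length v)
  ∈-vecsP⁺ []                 = here refl
  ∈-vecsP⁺ {x ∷ w} (x<p ∷ w<p) =
    subst (_ ∈_) (sym (vecsP-suc (length w))) (∈-cartesianProductWith⁺ _∷_ (∈-upTo⁺ x<p) (∈-vecsP⁺ w<p))

  vecsP-unique : ∀ n → Unique (vecsP p n)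
  vecsP-unique zero    = [] ∷ []
  vecsP-unique (suc n) = subst Unique (sym (vecsP-suc n))
    (Unique.cartesianProductWith⁺ _∷_ ∷-injective (Unique.upTo⁺ p) (vecsP-unique n))

  ∈-monicsP⁻ : ∀ N {f} → f ∈ monicsP p N → Σ[ w ∈ List ℕ ] length w ≡ N × All (_< p) w × f ≡ w ++ 1 ∷ []
  ∈-monicsP⁻ N f∈ with ∈-map⁻ (_++ 1 ∷ []) f∈
  ... | w , w∈ , refl with ∈-vecsP⁻ N w∈
  ...   | |w|≡N , w<p = w , |w|≡N , w<p , refl

  ∈-monicsP⁺ : ∀ {w} → All (_< p) w → w ++ 1 ∷ [] ∈ monicsP p (length w)
  ∈-monicsP⁺ w<p = ∈-map⁺ (_++ 1 ∷ []) (∈-vecsP⁺ w<p)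

  monicsP-unique : ∀ N → Unique (monicsP p N)
  monicsP-unique N = Unique.map⁺ (λ {w} {w'} → ∷ʳ-injectiveˡ w w') (vecsP-unique N)

module ShiftAction (r : ℕ) where

  open import Data.Nat as ℕ using (ℕ; suc; _<_; _∸_)
  import Data.Nat.Properties as ℕ
  open import Data.Nat.DivMod using (_%_)
  open import Data.Bool using (Bool; T; _∧_; not)
  open import Data.Bool.Properties using (T-∧)
  open import Data.Bool.ListAction using (any)
  open import Data.List using (map; _++_; length; replicate)
  open import Data.List.Properties using (length-++; length-replicate)
  open import Data.List.Membership.Propositional using (_∈_; find; lose)
  open import Data.List.Relation.Binary.Permutation.Propositional using (_↭_)
  open import Data.List.Relation.Unary.Any.Properties using (any⁺; any⁻)
  open import Data.List.Relation.Unary.All using (All)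
  import Data.List.Relation.Unary.All.Properties as All
  open import Data.Product using (Σ-syntax; _×_; _,_; proj₁)
  open import Function.Bundles using (Equivalence)
  open import Relation.Binary.PropositionalEquality using (_≡_; refl; sym; trans; cong; subst; subst₂)
  open ExactArithmetic
  open ModularArithmetic r
  open NormalForm r
  open BooleanTests
  open Counting using (map-↭)
  open Shift r
  open Enumeration r

  σ : ℕ → Poly → Poly
  σ b f = normP p (shiftP b f)

  σ-monicsP : ∀ b N {f} → f ∈ monicsP p N → σ b f ∈ monicsP p N
  σ-monicsP b N f∈ with ∈-monicsP⁻ N f∈
  ... | w , refl , _ , refl
    with deg , lead ← shiftP-degree b (w ∷ʳ 1) (length w) (DegreeBelow-∷ʳ w 1)
    with w' , |w'|≡|w| , normP≡ ← normP-monic (shiftP b (w ∷ʳ 1)) (length w) deg (trans lead (cong (_% p) (coeff-∷ʳ w 1)))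
    = subst₂ _∈_ (sym normP≡) (cong (monicsP p) |w'|≡|w|)
        (∈-monicsP⁺ (All.++⁻ˡ w' (subst (All (_< p)) normP≡ (normP-< (shiftP b (w ∷ʳ 1))))))

  σ-inverse : ∀ b c → (b ℕ.+ c) % p ≡ 0 → ∀ N {f} → f ∈ monicsP p N → σ c (σ b f) ≡ f
  σ-inverse b c b+c≡0 N {f} f∈ with ∈-monicsP⁻ N f∈
  ... | w , _ , w<p , refl = trans
    (≈ₚ⇒≈[p] (≈ₚ-trans (shiftP-cong c (normP-≈ₚ (shiftP b (w ∷ʳ 1)))) (shiftP-inverse b c b+c≡0 (w ∷ʳ 1))))
    (normP-monic-fixed w<p)

  σ-permutes-monicsP : ∀ b c → (b ℕ.+ c) % p ≡ 0 → (c ℕ.+ b) % p ≡ 0 → ∀ N → map (σ b) (monicsP p N) ↭ monicsP p N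
  σ-permutes-monicsP b c b+c≡0 c+b≡0 N =
    map-↭ (monicsP-unique N) (σ-monicsP b N) (σ-monicsP c N) (σ-inverse b c b+c≡0 N) (σ-inverse c b c+b≡0 N)

  -- irredB p N f unfolds to not (N ≤ᵇ 0) ∧ not (factorizable N f).
  factorizable : ℕ → Poly → Bool
  factorizable N f =
    any (λ g → any (λ h → posDegB p g ∧ posDegB p h ∧ eqB (normP p (mulP g h)) (normP p f)) (vecsP p N)) (vecsP p N)

  -- The witness is the normal form of g(T + b), padded with zeros to the length of g.
  shift-factor : ∀ b N {g} → g ∈ vecsP p (suc N) →
    Σ[ g' ∈ Poly ] g' ∈ vecsP p (suc N) × g' ≈ₚ shiftP b g × posDegB p g' ≡ posDegB p g
  shift-factor b N {g} g∈ = g' , g'∈ , g'≈ , cong (λ n → not (n ℕ.≤ᵇ 1)) size≡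
    where
    |g|≡1+N = proj₁ (∈-vecsP⁻ (suc N) g∈)
    w = σ b g
    g' = w ++ replicate (suc N ∸ length w) 0
    |w|≤1+N : length w ℕ.≤ suc N
    |w|≤1+N = sizeP-≤ (shiftP b g) (proj₁ (shiftP-degree b g N (subst (DegreeBelow g) |g|≡1+N (DegreeBelow-length g))))
    |g'|≡1+N : length g' ≡ suc N
    |g'|≡1+N = trans (length-++ w) (trans (cong (length w ℕ.+_) (length-replicate (suc N ∸ length w))) (ℕ.m+[n∸m]≡n |w|≤1+N))
    g'∈ : g' ∈ vecsP p (suc N)
    g'∈ = subst (λ n → g' ∈ vecsP p n) |g'|≡1+N
                (∈-vecsP⁺ (All.++⁺ (normP-< (shiftP b g)) (All.replicate⁺ (suc N ∸ length w) (ℕ.s≤s ℕ.z≤n))))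
    g'≈ : g' ≈ₚ shiftP b g
    g'≈ = ≈ₚ-trans (≋⇒≈ₚ (++-replicate-0 w (suc N ∸ length w))) (normP-≈ₚ (shiftP b g))
    size≡ : sizeP p g' ≡ sizeP p g
    size≡ = trans (sizeP-cong g'≈) (sizeP-shiftP b g)

  factorizable-shift : ∀ b N {F F'} → F' ≈ₚ shiftP b F → T (factorizable (suc N) F) → T (factorizable (suc N) F')
  factorizable-shift b N {F} {F'} F'≈ fac
    with g , g∈ , fac-g ← find (any⁻ _ (vecsP p (suc N)) fac)
    with h , h∈ , fac-gh ← find (any⁻ _ (vecsP p (suc N)) fac-g)
    with pos-g , rest ← Equivalence.to T-∧ fac-gh
    with pos-h , gh≡F ← Equivalence.to T-∧ rest
    with g' , g'∈ , g'≈ , pos-g'≡ ← shift-factor b N g∈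
    with h' , h'∈ , h'≈ , pos-h'≡ ← shift-factor b N h∈
    = any⁺ _ (lose g'∈ (any⁺ _ (lose h'∈ (Equivalence.from T-∧
        (subst T (sym pos-g'≡) pos-g , Equivalence.from T-∧ (subst T (sym pos-h'≡) pos-h , T-eqB⁺ g'h'≡F'))))))
    where
    g'h'≈F' : mulP g' h' ≈ₚ F'
    g'h'≈F' = ≈ₚ-trans (mulP-cong g'≈ h'≈) (≈ₚ-trans (≈ₚ-sym (shiftP-mulP b g h))
                (≈ₚ-trans (shiftP-cong b (≈[p]⇒≈ₚ {mulP g h} {F} (T-eqB⁻ gh≡F))) (≈ₚ-sym F'≈)))
    g'h'≡F' : normP p (mulP g' h') ≡ normP p F'
    g'h'≡F' = ≈ₚ⇒≈[p] g'h'≈F'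

  irredB-σ : ∀ b c → (b ℕ.+ c) % p ≡ 0 → ∀ N f → irredB p (suc N) (σ b f) ≡ irredB p (suc N) f
  irredB-σ b c b+c≡0 N f = cong not (T-⇔⇒≡
    (factorizable-shift c N {σ b f} {f} (≈ₚ-sym (≈ₚ-trans (shiftP-cong c (normP-≈ₚ (shiftP b f))) (shiftP-inverse b c b+c≡0 f))))
    (factorizable-shift b N {f} {σ b f} (normP-≈ₚ (shiftP b f))))

module CongruenceModM (r : ℕ) (p-prime : Prime (suc (suc r))) (a : ℕ) where

  open import Data.Nat as ℕ using (ℕ; _∸_)
  open import Data.Nat.DivMod using (_%_)
  open import Data.List using ([]; map)
  open import Data.Product using (_,_; proj₂)
  open import Relation.Binary.PropositionalEquality as ≡ using (_≡_)
  open ModularArithmetic r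
  open NormalForm r
  open SpecialPolynomials r
  open Shift r
  open BooleanTests using (T-⇔⇒≡)
  open ShiftAction r using (σ)
  open Modulus r a using (mPoly-monic)
  open MonicDivision r (mPoly p a) (proj₂ mPoly-monic) using (dvdMonicB-sound; dvdMonicB-complete)
  open CommutativeSemiring 𝔽ₚ[T] hiding (zero)
  open import Algebra.Solver.Ring.NaturalCoefficients.Default 𝔽ₚ[T]
  open import Relation.Binary.Reasoning.Setoid setoid

  m : Poly
  m = mPoly p a

  -- a record, so that f and g can be inferred from a proof
  record _≡_[mod-m] (f g : Poly) : Set where
    constructor mk≡[mod-m]
    field m∣f-g : CongMod p f g m
  open _≡_[mod-m]

  Divides-resp : ∀ {X Y} → X ≈ Y → Divides p m X → Divides p m Y
  Divides-resp {X} X≈Y (q , X≈mq) = q , ≈ₚ⇒≈[p] (trans (sym X≈Y) (≈[p]⇒≈ₚ {X} {m * q} X≈mq))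

  Divides-+ : ∀ {X Y} → Divides p m X → Divides p m Y → Divides p m (X + Y)
  Divides-+ {X} {Y} (q₁ , X≈mq₁) (q₂ , Y≈mq₂) = q₁ + q₂ , ≈ₚ⇒≈[p] (begin
    X + Y              ≈⟨ +-cong (≈[p]⇒≈ₚ {X} {m * q₁} X≈mq₁) (≈[p]⇒≈ₚ {Y} {m * q₂} Y≈mq₂) ⟩
    m * q₁ + m * q₂    ≈⟨ distribˡ m q₁ q₂ ⟨
    m * (q₁ + q₂)      ∎)

  Divides-*ˡ : ∀ c {X} → Divides p m X → Divides p m (c * X)
  Divides-*ˡ c {X} (q , X≈mq) = c * q , ≈ₚ⇒≈[p] (begin
    c * X          ≈⟨ *-congˡ {c} (≈[p]⇒≈ₚ {X} {m * q} X≈mq) ⟩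
    c * (m * q)    ≈⟨ solve 3 (λ c m q → c :* (m :* q) := m :* (c :* q)) refl c m q ⟩
    m * (c * q)    ∎)

  Divides-shiftP : ∀ b {X} → Divides p m X → Divides p m (shiftP b X)
  Divides-shiftP b {X} (q , X≈mq) = shiftP b q , ≈ₚ⇒≈[p] (begin
    shiftP b X                 ≈⟨ shiftP-cong b (≈[p]⇒≈ₚ {X} {m * q} X≈mq) ⟩
    shiftP b (m * q)           ≈⟨ shiftP-mulP b m q ⟩
    shiftP b m * shiftP b q    ≈⟨ *-congʳ {shiftP b q} (shiftP-mPoly p-prime b a) ⟩
    m * shiftP b q             ∎)

  ≈⇒≡[mod-m] : ∀ {f g} → f ≈ g → f ≡ g [mod-m]
  ≈⇒≡[mod-m] {f} {g} f≈g = mk≡[mod-m] ([] , ≈ₚ⇒≈[p] (begin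
    subP p f g    ≈⟨ subP≈+-1ₚ* f g ⟩
    f + -1ₚ * g   ≈⟨ +-congʳ { -1ₚ * g } f≈g ⟩
    g + -1ₚ * g   ≈⟨ f+-1ₚ*f≈0 g ⟩
    0#            ≈⟨ zeroʳ m ⟨
    m * []        ∎))

  ≡[mod-m]-sym : ∀ {f g} → f ≡ g [mod-m] → g ≡ f [mod-m]
  ≡[mod-m]-sym {f} {g} (mk≡[mod-m] f≡g) = mk≡[mod-m] (Divides-resp (begin
    -1ₚ * subP p f g              ≈⟨ *-congˡ { -1ₚ } (subP≈+-1ₚ* f g) ⟩
    -1ₚ * (f + -1ₚ * g)           ≈⟨ solve 3 (λ n f g → n :* (f :+ n :* g) := (n :* n) :* g :+ n :* f) refl -1ₚ f g ⟩
    (-1ₚ * -1ₚ) * g + -1ₚ * f     ≈⟨ +-congʳ { -1ₚ * f } (trans (*-congʳ {g} -1ₚ*-1ₚ) (*-identityˡ g)) ⟩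
    g + -1ₚ * f                   ≈⟨ subP≈+-1ₚ* g f ⟨
    subP p g f                    ∎) (Divides-*ˡ -1ₚ {subP p f g} f≡g))

  ≡[mod-m]-trans : ∀ {f g h} → f ≡ g [mod-m] → g ≡ h [mod-m] → f ≡ h [mod-m]
  ≡[mod-m]-trans {f} {g} {h} (mk≡[mod-m] f≡g) (mk≡[mod-m] g≡h) = mk≡[mod-m] (Divides-resp (begin
    subP p f g + subP p g h                ≈⟨ +-cong (subP≈+-1ₚ* f g) (subP≈+-1ₚ* g h) ⟩
    (f + -1ₚ * g) + (g + -1ₚ * h)          ≈⟨ solve 4 (λ f g h n → (f :+ n :* g) :+ (g :+ n :* h) := (f :+ n :* h) :+ (g :+ n :* g))
                                                    refl f g h -1ₚ ⟩
    (f + -1ₚ * h) + (g + -1ₚ * g)          ≈⟨ +-congˡ {f + -1ₚ * h} (f+-1ₚ*f≈0 g) ⟩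
    (f + -1ₚ * h) + 0#                     ≈⟨ +-identityʳ _ ⟩
    f + -1ₚ * h                            ≈⟨ subP≈+-1ₚ* f h ⟨
    subP p f h                             ∎) (Divides-+ {subP p f g} {subP p g h} f≡g g≡h))

  ≡[mod-m]-shiftP : ∀ b {f g} → f ≡ g [mod-m] → shiftP b f ≡ shiftP b g [mod-m]
  ≡[mod-m]-shiftP b {f} {g} (mk≡[mod-m] f≡g) = mk≡[mod-m] (Divides-resp (begin
    shiftP b (f + map ((p ∸ 1) ℕ.*_) g)          ≈⟨ shiftP-addP b f (map ((p ∸ 1) ℕ.*_) g) ⟩
    shiftP b f + shiftP b (map ((p ∸ 1) ℕ.*_) g) ≈⟨ +-congˡ {shiftP b f} (shiftP-scale b (p ∸ 1) g) ⟩
    shiftP b f + -1ₚ * shiftP b g                ≈⟨ subP≈+-1ₚ* (shiftP b f) (shiftP b g) ⟨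
    subP p (shiftP b f) (shiftP b g)             ∎) (Divides-shiftP b {subP p f g} f≡g))

  congMonicB-σ : ∀ b c → (b ℕ.+ c) % p ≡ 0 → ∀ {c₁ c₂} → c₂ ≡ shiftP b c₁ [mod-m] →
                 ∀ f → congMonicB p (σ b f) c₂ m ≡ congMonicB p f c₁ m
  congMonicB-σ b c b+c≡0 {c₁} {c₂} c₂≡c₁[T+b] f =
    T-⇔⇒≡ (λ t → dvdMonicB-complete (subP p f c₁)
                    (m∣f-g (backward (mk≡[mod-m] (dvdMonicB-sound (subP p (σ b f) c₂) t)))))
          (λ t → dvdMonicB-complete (subP p (σ b f) c₂)
                    (m∣f-g (forward (mk≡[mod-m] (dvdMonicB-sound (subP p f c₁) t)))))
    where
    σf≡f[T+b] : σ b f ≡ shiftP b f [mod-m]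
    σf≡f[T+b] = ≈⇒≡[mod-m] (normP-≈ₚ (shiftP b f))
    forward : f ≡ c₁ [mod-m] → σ b f ≡ c₂ [mod-m]
    forward f≡c₁ = ≡[mod-m]-trans σf≡f[T+b] (≡[mod-m]-trans (≡[mod-m]-shiftP b f≡c₁) (≡[mod-m]-sym c₂≡c₁[T+b]))
    backward : σ b f ≡ c₂ [mod-m] → f ≡ c₁ [mod-m]
    backward σf≡c₂ = ≡[mod-m]-trans (≈⇒≡[mod-m] (sym (shiftP-inverse b c b+c≡0 f)))
      (≡[mod-m]-trans (≡[mod-m]-shiftP c f[T+b]≡c₁[T+b]) (≈⇒≡[mod-m] (shiftP-inverse b c b+c≡0 c₁)))
      where
      f[T+b]≡c₁[T+b] : shiftP b f ≡ shiftP b c₁ [mod-m]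
      f[T+b]≡c₁[T+b] = ≡[mod-m]-trans (≡[mod-m]-sym σf≡f[T+b]) (≡[mod-m]-trans σf≡c₂ c₂≡c₁[T+b])

open Counting using (countB-cong; countB-map; countB-↭)

mainTheorem10 : (p : ℕ) → Prime p → (a : ℕ) → 0 < a → a < p →
    (c₁ c₂ : Poly) → Coprime p c₁ (mPoly p a) → Coprime p c₂ (mPoly p a) →
    (b : ℕ) → b < p → CongMod p c₂ (shiftP b c₁) (mPoly p a) →
    (N : ℕ) → 1 ≤ N → πP p N (mPoly p a) c₁ ≡ πP p N (mPoly p a) c₂
mainTheorem10 p@(suc (suc r)) p-prime a _ _ c₁ c₂ _ _ b b<p c₂≡c₁[T+b] (suc N) _ = begin
  countB Q₁ monics                  ≡⟨ countB-cong Q₁≡Q₂∘σ monics ⟩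
  countB (λ f → Q₂ (σ b f)) monics  ≡⟨ countB-map Q₂ (σ b) monics ⟨
  countB Q₂ (map (σ b) monics)      ≡⟨ countB-↭ Q₂ (σ-permutes-monicsP b c b+c≡0 c+b≡0 (suc N)) ⟩
  countB Q₂ monics                  ∎
  where
  open ≡.≡-Reasoning
  open ShiftAction r using (σ; σ-permutes-monicsP; irredB-σ)
  open CongruenceModM r p-prime a using (congMonicB-σ; mk≡[mod-m])
  monics = monicsP p (suc N)
  c = p ℕ.∸ b
  Q₁ Q₂ : Poly → Bool
  Q₁ f = irredB p (suc N) f ∧ congMonicB p f c₁ (mPoly p a)
  Q₂ f = irredB p (suc N) f ∧ congMonicB p f c₂ (mPoly p a)
  b+c≡0 : (b ℕ.+ c) % p ≡ 0
  b+c≡0 = ≡.trans (≡.cong (_% p) (ℕ.m+[n∸m]≡n (ℕ.<⇒≤ b<p))) (n%n≡0 p)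
  c+b≡0 : (c ℕ.+ b) % p ≡ 0
  c+b≡0 = ≡.trans (≡.cong (_% p) (ℕ.+-comm c b)) b+c≡0
  Q₁≡Q₂∘σ : ∀ f → Q₁ f ≡ Q₂ (σ b f)
  Q₁≡Q₂∘σ f = ≡.sym (≡.cong₂ _∧_ (irredB-σ b c b+c≡0 N f) (congMonicB-σ b c b+c≡0 (mk≡[mod-m] c₂≡c₁[T+b]) f))
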